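{- Every fragment $\Sigma_1,\mathcal{R}_1$ of the system $\mathcal{U}=\Sigma_{\mathcal{U}},\mathcal{R}_{\mathcal{U}}$ (including $\mathcal{U}$ itself) is a theory, that is, $\hookrightarrow_{\beta\mathcal{R}_1}$ is confluent on $\Lambda(\Sigma_1)$ and every rule of $\mathcal{R}_1$ preserves typing in $\Sigma_1,\mathcal{R}_1$.
   Context: Framework: the $\lambda\Pi$-calculus modulo theory. Terms $t ::= c\mid x\mid\mathtt{TYPE}\mid\mathtt{KIND}\mid\Pi x:t.u\mid\lambda x:t.u\mid t\,u$; $A\to B$ abbreviates $\Pi x:A.B$ with $x$ not free in $B$. Rules $\ell\hookrightarrow r$ have $\ell=c\,\ell_1\ldots\ell_n$ ($n\geq0$), free variables of rules act as pattern variables; $\hookrightarrow_{\mathcal{R}}$ is the closure of $\mathcal{R}$ under term constructors and substitution, $\hookrightarrow_{\beta\mathcal{R}}=\hookrightarrow_\beta\cup\hookrightarrow_{\mathcal{R}}$, $\equiv_{\beta\mathcal{R}}$ its equivalence closure. A signature $\Sigma$ is a list of declarations $c:A$ ($A$ closed), $|\Sigma|$ its set of constants, $\Lambda(\Sigma)$ the terms whose constants lie in $|\Sigma|$. Typing (with sorts $s\in\{\mathtt{TYPE},\mathtt{KIND}\}$): (empty) $\vdash[\,]$ wf; (decl) $\Gamma\vdash A:s\Rightarrow\ \vdash\Gamma,x:A$ wf; (sort) $\vdash\Gamma$ wf $\Rightarrow\Gamma\vdash\mathtt{TYPE}:\mathtt{KIND}$; (const) $\vdash\Gamma$ wf, $\vdash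 A:s$, $c:A\in\Sigma\Rightarrow\Gamma\vdash c:A$; (var) $\vdash\Gamma$ wf, $x:A\in\Gamma\Rightarrow\Gamma\vdash x:A$; (prod) $\Gamma\vdash A:\mathtt{TYPE}$, $\Gamma,x:A\vdash B:s\Rightarrow\Gamma\vdash\Pi x:A.B:s$; (abs) $\Gamma\vdash A:\mathtt{TYPE}$, $\Gamma,x:A\vdash B:s$, $\Gamma,x:A\vdash t:B\Rightarrow\Gamma\vdash\lambda x:A.t:\Pi x:A.B$; (app) $\Gamma\vdash t:\Pi x:A.B$, $\Gamma\vdash u:A\Rightarrow\Gamma\vdash t\,u:(u/x)B$; (conv) $\Gamma\vdash t:A$, $\Gamma\vdash B:s$, $A\equiv_{\beta\mathcal{R}}B\Rightarrow\Gamma\vdash t:B$; judgements written $\vdash_{\Sigma,\mathcal{R}}$. A system is a pair $\Sigma,\mathcal{R}$ with all rules in $\Lambda(\Sigma)$. A rule $\ell\hookrightarrow r$ preserves typing in $\Sigma,\mathcal{R}$ if for all contexts $\Gamma$, substitutions $\theta$ and terms $A$ in $\Lambda(\Sigma)$, $\Gamma\vdash_{\Sigma,\mathcal{R}}\theta\ell:A$ implies $\Gamma\vdash_{\Sigma,\mathcal{R}}\theta r:A$. A theory is a system with $\hookrightarrow_{\beta\mathcal{R}}$ confluent on $\Lambda(\Sigma)$ and all rules preserving typing. A fragment $\Sigma_1,\mathcal{R}_1$ of $\Sigma_0,\mathcal{R}_0$: every declaration of $\Sigma_1$ is in $\Sigma_0$, $\mathcal{R}_1\subseteq\mathcal{R}_0$,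 the type of each constant of $\Sigma_1$ has all constants in $|\Sigma_1|$, and every rule of $\mathcal{R}_0$ whose left side has all constants in $|\Sigma_1|$ has its right side with all constants in $|\Sigma_1|$ and belongs to $\mathcal{R}_1$. The system $\mathcal{U}$ has signature $\Sigma_{\mathcal{U}}$ consisting of the following 43 declarations and $\mathcal{R}_{\mathcal{U}}$ of the following 31 rules ($\Rightarrow,\wedge,\vee,\Rightarrow_c,\wedge_c,\vee_c,\leadsto,\leadsto_d,\Rightarrow_d,\rightsquigarrow_d$ written infix): $I:\mathtt{TYPE}$; $\mathit{Set}:\mathtt{TYPE}$; $\mathit{El}:\mathit{Set}\to\mathtt{TYPE}$; $\iota:\mathit{Set}$, $\mathit{El}\,\iota\hookrightarrow I$; $\mathit{Prop}:\mathtt{TYPE}$; $\mathit{Prf}:\mathit{Prop}\to\mathtt{TYPE}$; $\Rightarrow:\mathit{Prop}\to\mathit{Prop}\to\mathit{Prop}$, $\mathit{Prf}(x\Rightarrow y)\hookrightarrow\mathit{Prf}\,x\to\mathit{Prf}\,y$; $\forall:\Pi x:\mathit{Set}.(\mathit{El}\,x\to\mathit{Prop})\to\mathit{Prop}$, $\mathit{Prf}(\forall\,x\,p)\hookrightarrow\Pi z:\mathit{El}\,x.\mathit{Prf}(p\,z)$; $\top:\mathit{Prop}$, $\mathit{Prf}\,\top\hookrightarrow\Pi z:\mathit{Prop}.\mathit{Prf}\,z\to\mathit{Prf}\,z$; $\bot:\mathit{Prop}$, $\mathit{Prf}\,\bot\hookrightarrow\Pi z:\mathit{Prop}.\mathit{Prf}\,z$;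 $\neg:\mathit{Prop}\to\mathit{Prop}$, $\mathit{Prf}(\neg x)\hookrightarrow\mathit{Prf}\,x\to\Pi z:\mathit{Prop}.\mathit{Prf}\,z$; $\wedge:\mathit{Prop}\to\mathit{Prop}\to\mathit{Prop}$, $\mathit{Prf}(x\wedge y)\hookrightarrow\Pi z:\mathit{Prop}.(\mathit{Prf}\,x\to\mathit{Prf}\,y\to\mathit{Prf}\,z)\to\mathit{Prf}\,z$; $\vee:\mathit{Prop}\to\mathit{Prop}\to\mathit{Prop}$, $\mathit{Prf}(x\vee y)\hookrightarrow\Pi z:\mathit{Prop}.(\mathit{Prf}\,x\to\mathit{Prf}\,z)\to(\mathit{Prf}\,y\to\mathit{Prf}\,z)\to\mathit{Prf}\,z$; $\exists:\Pi a:\mathit{Set}.(\mathit{El}\,a\to\mathit{Prop})\to\mathit{Prop}$, $\mathit{Prf}(\exists\,a\,p)\hookrightarrow\Pi z:\mathit{Prop}.(\Pi x:\mathit{El}\,a.\mathit{Prf}(p\,x)\to\mathit{Prf}\,z)\to\mathit{Prf}\,z$; $\mathit{Prf}_c:\mathit{Prop}\to\mathtt{TYPE}$, $\mathit{Prf}_c\hookrightarrow\lambda x:\mathit{Prop}.\mathit{Prf}(\neg\neg x)$; $\Rightarrow_c,\wedge_c,\vee_c:\mathit{Prop}\to\mathit{Prop}\to\mathit{Prop}$ with $\Rightarrow_c\hookrightarrow\lambda x:\mathit{Prop}.\lambda y:\mathit{Prop}.(\neg\neg x)\Rightarrow(\neg\neg y)$ and likewise $\wedge_c\hookrightarrow\lambda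 x.\lambda y.(\neg\neg x)\wedge(\neg\neg y)$, $\vee_c\hookrightarrow\lambda x.\lambda y.(\neg\neg x)\vee(\neg\neg y)$; $\forall_c,\exists_c:\Pi a:\mathit{Set}.(\mathit{El}\,a\to\mathit{Prop})\to\mathit{Prop}$ with $\forall_c\hookrightarrow\lambda a:\mathit{Set}.\lambda p:(\mathit{El}\,a\to\mathit{Prop}).\forall\,a\,(\lambda x:\mathit{El}\,a.\neg\neg(p\,x))$ and $\exists_c\hookrightarrow\lambda a:\mathit{Set}.\lambda p:(\mathit{El}\,a\to\mathit{Prop}).\exists\,a\,(\lambda x:\mathit{El}\,a.\neg\neg(p\,x))$; $o:\mathit{Set}$, $\mathit{El}\,o\hookrightarrow\mathit{Prop}$; $\leadsto:\mathit{Set}\to\mathit{Set}\to\mathit{Set}$, $\mathit{El}(x\leadsto y)\hookrightarrow\mathit{El}\,x\to\mathit{El}\,y$; $\leadsto_d:\Pi x:\mathit{Set}.(\mathit{El}\,x\to\mathit{Set})\to\mathit{Set}$, $\mathit{El}(x\leadsto_d y)\hookrightarrow\Pi z:\mathit{El}\,x.\mathit{El}(y\,z)$; $\Rightarrow_d:\Pi x:\mathit{Prop}.(\mathit{Prf}\,x\to\mathit{Prop})\to\mathit{Prop}$, $\mathit{Prf}(x\Rightarrow_d y)\hookrightarrow\Pi z:\mathit{Prf}\,x.\mathit{Prf}(y\,z)$; $\pi:\Pi x:\mathit{Prop}.(\mathit{Prf}\,x\to\mathit{Set})\to\mathit{Set}$, $\mathit{El}(\pi\,x\,y)\hookrightarrow\Pi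 z:\mathit{Prf}\,x.\mathit{El}(y\,z)$; $0:I$; $\mathit{succ}:I\to I$; $\mathit{pred}:I\to I$, $\mathit{pred}\,0\hookrightarrow0$, $\mathit{pred}(\mathit{succ}\,x)\hookrightarrow x$; $\mathit{positive}:I\to\mathit{Prop}$, $\mathit{positive}\,0\hookrightarrow\bot$, $\mathit{positive}(\mathit{succ}\,x)\hookrightarrow\top$; $\mathit{psub}:\Pi t:\mathit{Set}.(\mathit{El}\,t\to\mathit{Prop})\to\mathit{Set}$; $\mathit{pair}:\Pi t:\mathit{Set}.\Pi p:(\mathit{El}\,t\to\mathit{Prop}).\Pi m:\mathit{El}\,t.\mathit{Prf}(p\,m)\to\mathit{El}(\mathit{psub}\,t\,p)$; $\mathit{pair}^\dagger:\Pi t:\mathit{Set}.\Pi p:(\mathit{El}\,t\to\mathit{Prop}).\mathit{El}\,t\to\mathit{El}(\mathit{psub}\,t\,p)$, $\mathit{pair}\,t\,p\,m\,h\hookrightarrow\mathit{pair}^\dagger\,t\,p\,m$; $\mathit{fst}:\Pi t:\mathit{Set}.\Pi p:(\mathit{El}\,t\to\mathit{Prop}).\mathit{El}(\mathit{psub}\,t\,p)\to\mathit{El}\,t$, $\mathit{fst}\,t\,p\,(\mathit{pair}^\dagger\,t'\,p'\,m)\hookrightarrow m$; $\mathit{snd}:\Pi t:\mathit{Set}.\Pi p:(\mathit{El}\,t\to\mathit{Prop}).\Pi m:\mathit{El}(\mathit{psub}\,t\,p).\mathit{Prf}(p(\mathit{fst}\,t\,p\,m))$; $\mathit{Set1}:\mathtt{TYPE}$;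 $\mathit{set}:\mathit{Set1}$; $\rightsquigarrow_d:\Pi x:\mathit{Set}.(\mathit{El}\,x\to\mathit{Set1})\to\mathit{Set1}$; $\mathit{Ty}:\mathit{Set1}\to\mathtt{TYPE}$, $\mathit{Ty}\,\mathit{set}\hookrightarrow\mathit{Set}$, $\mathit{Ty}(x\rightsquigarrow_d y)\hookrightarrow\Pi z:\mathit{El}\,x.\mathit{Ty}(y\,z)$; $\mathit{Scheme}:\mathtt{TYPE}$; $\mathit{Els}:\mathit{Scheme}\to\mathtt{TYPE}$; $\uparrow:\mathit{Set}\to\mathit{Scheme}$, $\mathit{Els}(\uparrow x)\hookrightarrow\mathit{El}\,x$; $\mathsf{A}:(\mathit{Set}\to\mathit{Scheme})\to\mathit{Scheme}$, $\mathit{Els}(\mathsf{A}\,p)\hookrightarrow\Pi x:\mathit{Set}.\mathit{Els}(p\,x)$; $\mathcal{A}:(\mathit{Set}\to\mathit{Prop})\to\mathit{Prop}$, $\mathit{Prf}(\mathcal{A}\,p)\hookrightarrow\Pi x:\mathit{Set}.\mathit{Prf}(p\,x)$. -}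

module Defs where

open import Data.Nat using (ℕ; zero; suc)
open import Data.Product using (Σ; ∃; _×_; _,_)
open import Data.List using (List; []; _∷_)
open import Data.List.Membership.Propositional using (_∈_)
open import Data.List.Relation.Unary.All using (All)
open import Relation.Binary.PropositionalEquality using (_≡_)
open import Relation.Binary.Construct.Closure.ReflexiveTransitive using (Star)
open import Relation.Binary.Construct.Closure.Equivalence using (EqClosure)

data Const : Set where
  cI cSet cEl cι cProp cPrf cImp cAll cTop cBot cNeg cAnd cOr cEx : Const
  cPrfc cImpc cAndc cOrc cAllc cExc : Const
  co cArrS cArrSd cImpd cπ c0 cSucc cPred cPositive : Const
  cPsub cPair cPair† cFst cSnd cSet1 cset cArrd1 cTy : Const
  cScheme cEls c↑ cSA cPA : Const

data Tm : Set where
  con  : Const → Tm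
  var  : ℕ → Tm
  TYPE : Tm
  KIND : Tm
  Pi   : Tm → Tm → Tm      -- Π x:A.B, B under one binder
  lam  : Tm → Tm → Tm      -- λ x:A.t, t under one binder
  _·_  : Tm → Tm → Tm

infixl 9 _·_

ext : (ℕ → ℕ) → ℕ → ℕ
ext ρ zero    = zero
ext ρ (suc n) = suc (ρ n)

rename : (ℕ → ℕ) → Tm → Tm
rename ρ (con c)   = con c
rename ρ (var n)   = var (ρ n)
rename ρ TYPE      = TYPE
rename ρ KIND      = KIND
rename ρ (Pi A B)  = Pi (rename ρ A) (rename (ext ρ) B)
rename ρ (lam A t) = lam (rename ρ A) (rename (ext ρ) t)
rename ρ (t · u)   = rename ρ t · rename ρ u

wk : Tm → Tm
wk = rename suc

Subst : Set
Subst = ℕ → Tm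

exts : Subst → Subst
exts σ zero    = var zero
exts σ (suc n) = wk (σ n)

sub : Subst → Tm → Tm
sub σ (con c)   = con c
sub σ (var n)   = σ n
sub σ TYPE      = TYPE
sub σ KIND      = KIND
sub σ (Pi A B)  = Pi (sub σ A) (sub (exts σ) B)
sub σ (lam A t) = lam (sub σ A) (sub (exts σ) t)
sub σ (t · u)   = sub σ t · sub σ u

-- (u/x)t where x is the de Bruijn index 0
single : Tm → Subst
single u zero    = u
single u (suc n) = var n

_[_] : Tm → Tm → Tm
t [ u ] = sub (single u) t

arr : Tm → Tm → Tm
arr A B = Pi A (wk B)

Decl : Set
Decl = Const × Tm

Signature : Set
Signature = List Decl

_∈∣_∣ : Const → Signature → Set
c ∈∣ Sig ∣ = ∃ λ A → (c , A) ∈ Sig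

data Occurs (c : Const) : Tm → Set where
  here  : Occurs c (con c)
  piˡ   : ∀ {A B} → Occurs c A → Occurs c (Pi A B)
  piʳ   : ∀ {A B} → Occurs c B → Occurs c (Pi A B)
  lamˡ  : ∀ {A t} → Occurs c A → Occurs c (lam A t)
  lamʳ  : ∀ {A t} → Occurs c t → Occurs c (lam A t)
  appˡ  : ∀ {t u} → Occurs c t → Occurs c (t · u)
  appʳ  : ∀ {t u} → Occurs c u → Occurs c (t · u)

InΛ : Signature → Tm → Set
InΛ Sig t = ∀ c → Occurs c t → c ∈∣ Sig ∣

-- rewrite rules ℓ ↪ r; free variables (de Bruijn indices) are pattern variables
infix 4 _↪_
record Rule : Set where
  constructor _↪_
  field
    lhs : Tm
    rhs : Tm
open Rule public

Rules : Set
Rules = List Rule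

data _⊢_↪βR_ (R : Rules) : Tm → Tm → Set where
  rule : ∀ {ρ} → ρ ∈ R → (θ : Subst) → R ⊢ sub θ (lhs ρ) ↪βR sub θ (rhs ρ)
  beta : ∀ {A t u} → R ⊢ (lam A t · u) ↪βR (t [ u ])
  piˡ  : ∀ {A A' B} → R ⊢ A ↪βR A' → R ⊢ Pi A B ↪βR Pi A' B
  piʳ  : ∀ {A B B'} → R ⊢ B ↪βR B' → R ⊢ Pi A B ↪βR Pi A B'
  lamˡ : ∀ {A A' t} → R ⊢ A ↪βR A' → R ⊢ lam A t ↪βR lam A' t
  lamʳ : ∀ {A t t'} → R ⊢ t ↪βR t' → R ⊢ lam A t ↪βR lam A t'
  appˡ : ∀ {t t' u} → R ⊢ t ↪βR t' → R ⊢ (t · u) ↪βR (t' · u)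
  appʳ : ∀ {t u u'} → R ⊢ u ↪βR u' → R ⊢ (t · u) ↪βR (t · u')

_⊢_↪*_ : Rules → Tm → Tm → Set
R ⊢ t ↪* u = Star (R ⊢_↪βR_) t u

_⊢_≡βR_ : Rules → Tm → Tm → Set
R ⊢ t ≡βR u = EqClosure (R ⊢_↪βR_) t u

data IsSort : Tm → Set where
  sTYPE : IsSort TYPE
  sKIND : IsSort KIND

-- contexts, most recent declaration first; types are relative to the rest
Ctx : Set
Ctx = List Tm

data _∋_⦂_ : Ctx → ℕ → Tm → Set where
  here  : ∀ {Γ A} → (A ∷ Γ) ∋ zero ⦂ wk A
  there : ∀ {Γ A B n} → Γ ∋ n ⦂ A → (B ∷ Γ) ∋ suc n ⦂ wk A

mutual
  data WF (Sig : Signature) (R : Rules) : Ctx → Set where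
    empty : WF Sig R []
    decl  : ∀ {Γ A s} → IsSort s → Ty Sig R Γ A s → WF Sig R (A ∷ Γ)

  data Ty (Sig : Signature) (R : Rules) : Ctx → Tm → Tm → Set where
    sort  : ∀ {Γ} → WF Sig R Γ → Ty Sig R Γ TYPE KIND
    const : ∀ {Γ c A s} → WF Sig R Γ → IsSort s → Ty Sig R [] A s →
            (c , A) ∈ Sig → Ty Sig R Γ (con c) A
    var   : ∀ {Γ x A} → WF Sig R Γ → Γ ∋ x ⦂ A → Ty Sig R Γ (var x) A
    prod  : ∀ {Γ A B s} → IsSort s → Ty Sig R Γ A TYPE →
            Ty Sig R (A ∷ Γ) B s → Ty Sig R Γ (Pi A B) s
    abs   : ∀ {Γ A B s t} → IsSort s → Ty Sig R Γ A TYPE →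
            Ty Sig R (A ∷ Γ) B s → Ty Sig R (A ∷ Γ) t B →
            Ty Sig R Γ (lam A t) (Pi A B)
    app   : ∀ {Γ t u A B} → Ty Sig R Γ t (Pi A B) → Ty Sig R Γ u A →
            Ty Sig R Γ (t · u) (B [ u ])
    conv  : ∀ {Γ t A B s} → Ty Sig R Γ t A → IsSort s → Ty Sig R Γ B s →
            R ⊢ A ≡βR B → Ty Sig R Γ t B

IsSystem : Signature → Rules → Set
IsSystem Sig R = ∀ ρ → ρ ∈ R → InΛ Sig (lhs ρ) × InΛ Sig (rhs ρ)

ConfluentOn : Signature → Rules → Set
ConfluentOn Sig R = ∀ t u v → InΛ Sig t → R ⊢ t ↪* u → R ⊢ t ↪* v →
                    ∃ λ w → (R ⊢ u ↪* w) × (R ⊢ v ↪* w)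

PreservesTyping : Signature → Rules → Rule → Set
PreservesTyping Sig R ρ =
  ∀ (Γ : Ctx) (θ : Subst) (A : Tm) →
  All (InΛ Sig) Γ → (∀ n → InΛ Sig (θ n)) → InΛ Sig A →
  Ty Sig R Γ (sub θ (lhs ρ)) A → Ty Sig R Γ (sub θ (rhs ρ)) A

record IsTheory (Sig : Signature) (R : Rules) : Set where
  field
    system     : IsSystem Sig R
    confluence : ConfluentOn Sig R
    preserve   : ∀ ρ → ρ ∈ R → PreservesTyping Sig R ρ

record IsFragment (Sig₁ : Signature) (R₁ : Rules) (Sig₀ : Signature) (R₀ : Rules) : Set where
  field
    system   : IsSystem Sig₁ R₁
    declsSub : ∀ d → d ∈ Sig₁ → d ∈ Sig₀
    rulesSub : ∀ ρ → ρ ∈ R₁ → ρ ∈ R₀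
    typesIn  : ∀ c A → (c , A) ∈ Sig₁ → InΛ Sig₁ A
    closed   : ∀ ρ → ρ ∈ R₀ → InΛ Sig₁ (lhs ρ) → InΛ Sig₁ (rhs ρ) × ρ ∈ R₁

private
  v : ℕ → Tm
  v = var
  κ : Const → Tm
  κ = con

I Set' El ι Prop Prf imp all top bot neg and or ex : Tm
I = κ cI ; Set' = κ cSet ; El = κ cEl ; ι = κ cι ; Prop = κ cProp ; Prf = κ cPrf
imp = κ cImp ; all = κ cAll ; top = κ cTop ; bot = κ cBot ; neg = κ cNeg
and = κ cAnd ; or = κ cOr ; ex = κ cEx
Prfc impc andc orc allc exc o arrS arrSd impd π z succ pred positive : Tm
Prfc = κ cPrfc ; impc = κ cImpc ; andc = κ cAndc ; orc = κ cOrc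
allc = κ cAllc ; exc = κ cExc ; o = κ co ; arrS = κ cArrS ; arrSd = κ cArrSd
impd = κ cImpd ; π = κ cπ ; z = κ c0 ; succ = κ cSucc ; pred = κ cPred
positive = κ cPositive
psub pair pair† fst snd SetOne set arrd1 TyC Scheme Els up SA PA : Tm
psub = κ cPsub ; pair = κ cPair ; pair† = κ cPair† ; fst = κ cFst ; snd = κ cSnd
SetOne = κ cSet1 ; set = κ cset ; arrd1 = κ cArrd1 ; TyC = κ cTy
Scheme = κ cScheme ; Els = κ cEls ; up = κ c↑ ; SA = κ cSA ; PA = κ cPA

private
  quantTy : Tm → Tm → Tm → Tm
  quantTy D F T = Pi D (arr (arr (F · v 0) T) T)
  binProp : Tm
  binProp = arr Prop (arr Prop Prop)
  nn : Tm → Tm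
  nn x = neg · (neg · x)

ΣU : Signature
ΣU =
  (cI , TYPE) ∷
  (cSet , TYPE) ∷
  (cEl , arr Set' TYPE) ∷
  (cι , Set') ∷
  (cProp , TYPE) ∷
  (cPrf , arr Prop TYPE) ∷
  (cImp , binProp) ∷
  (cAll , quantTy Set' El Prop) ∷
  (cTop , Prop) ∷
  (cBot , Prop) ∷
  (cNeg , arr Prop Prop) ∷
  (cAnd , binProp) ∷
  (cOr , binProp) ∷
  (cEx , quantTy Set' El Prop) ∷
  (cPrfc , arr Prop TYPE) ∷
  (cImpc , binProp) ∷
  (cAndc , binProp) ∷
  (cOrc , binProp) ∷
  (cAllc , quantTy Set' El Prop) ∷
  (cExc , quantTy Set' El Prop) ∷
  (co , Set') ∷
  (cArrS , arr Set' (arr Set' Set')) ∷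
  (cArrSd , quantTy Set' El Set') ∷
  (cImpd , quantTy Prop Prf Prop) ∷
  (cπ , quantTy Prop Prf Set') ∷
  (c0 , I) ∷
  (cSucc , arr I I) ∷
  (cPred , arr I I) ∷
  (cPositive , arr I Prop) ∷
  (cPsub , Pi Set' (arr (arr (El · v 0) Prop) Set')) ∷
  (cPair , Pi Set' (Pi (arr (El · v 0) Prop)
             (Pi (El · v 1) (arr (Prf · (v 1 · v 0)) (El · (psub · v 2 · v 1)))))) ∷
  (cPair† , Pi Set' (Pi (arr (El · v 0) Prop) (arr (El · v 1) (El · (psub · v 1 · v 0))))) ∷
  (cFst , Pi Set' (Pi (arr (El · v 0) Prop) (arr (El · (psub · v 1 · v 0)) (El · v 1)))) ∷
  (cSnd , Pi Set' (Pi (arr (El · v 0) Prop)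
             (Pi (El · (psub · v 1 · v 0)) (Prf · (v 1 · (fst · v 2 · v 1 · v 0)))))) ∷
  (cSet1 , TYPE) ∷
  (cset , SetOne) ∷
  (cArrd1 , quantTy Set' El SetOne) ∷
  (cTy , arr SetOne TYPE) ∷
  (cScheme , TYPE) ∷
  (cEls , arr Scheme TYPE) ∷
  (c↑ , arr Set' Scheme) ∷
  (cSA , arr (arr Set' Scheme) Scheme) ∷
  (cPA , arr (arr Set' Prop) Prop) ∷
  []

RU : Rules
RU =
  (El · ι ↪ I) ∷
  (Prf · (imp · v 0 · v 1) ↪ arr (Prf · v 0) (Prf · v 1)) ∷
  (Prf · (all · v 0 · v 1) ↪ Pi (El · v 0) (Prf · (v 2 · v 0))) ∷
  (Prf · top ↪ Pi Prop (arr (Prf · v 0) (Prf · v 0))) ∷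
  (Prf · bot ↪ Pi Prop (Prf · v 0)) ∷
  (Prf · (neg · v 0) ↪ arr (Prf · v 0) (Pi Prop (Prf · v 0))) ∷
  (Prf · (and · v 0 · v 1) ↪
     Pi Prop (arr (arr (Prf · v 1) (arr (Prf · v 2) (Prf · v 0))) (Prf · v 0))) ∷
  (Prf · (or · v 0 · v 1) ↪
     Pi Prop (arr (arr (Prf · v 1) (Prf · v 0))
                  (arr (arr (Prf · v 2) (Prf · v 0)) (Prf · v 0)))) ∷
  (Prf · (ex · v 0 · v 1) ↪
     Pi Prop (arr (Pi (El · v 1) (arr (Prf · (v 3 · v 0)) (Prf · v 1))) (Prf · v 0))) ∷
  (Prfc ↪ lam Prop (Prf · nn (v 0))) ∷
  (impc ↪ lam Prop (lam Prop (imp · nn (v 1) · nn (v 0)))) ∷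
  (andc ↪ lam Prop (lam Prop (and · nn (v 1) · nn (v 0)))) ∷
  (orc ↪ lam Prop (lam Prop (or · nn (v 1) · nn (v 0)))) ∷
  (allc ↪ lam Set' (lam (arr (El · v 0) Prop)
            (all · v 1 · lam (El · v 1) (nn (v 1 · v 0))))) ∷
  (exc ↪ lam Set' (lam (arr (El · v 0) Prop)
            (ex · v 1 · lam (El · v 1) (nn (v 1 · v 0))))) ∷
  (El · o ↪ Prop) ∷
  (El · (arrS · v 0 · v 1) ↪ arr (El · v 0) (El · v 1)) ∷
  (El · (arrSd · v 0 · v 1) ↪ Pi (El · v 0) (El · (v 2 · v 0))) ∷
  (Prf · (impd · v 0 · v 1) ↪ Pi (Prf · v 0) (Prf · (v 2 · v 0))) ∷
  (El · (π · v 0 · v 1) ↪ Pi (Prf · v 0) (El · (v 2 · v 0))) ∷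
  (pred · z ↪ z) ∷
  (pred · (succ · v 0) ↪ v 0) ∷
  (positive · z ↪ bot) ∷
  (positive · (succ · v 0) ↪ top) ∷
  (pair · v 0 · v 1 · v 2 · v 3 ↪ pair† · v 0 · v 1 · v 2) ∷
  (fst · v 0 · v 1 · (pair† · v 2 · v 3 · v 4) ↪ v 4) ∷
  (TyC · set ↪ Set') ∷
  (TyC · (arrd1 · v 0 · v 1) ↪ Pi (El · v 0) (TyC · (v 2 · v 0))) ∷
  (Els · (up · v 0) ↪ El · v 0) ∷
  (Els · (SA · v 0) ↪ Pi Set' (Els · (v 1 · v 0))) ∷
  (Prf · (PA · v 0) ↪ Pi Set' (Prf · (v 1 · v 0))) ∷
  []

module Submission where

-- β-reduction together with the rules of U is an orthogonal pattern rewrite system: the left sides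
-- are linear patterns of constants that never overlap, so Tait–Martin-Löf parallel reduction has the
-- diamond property and ↪βR is confluent on all terms, for any subset of the rules. Confluence makes Π
-- (and El ∘ psub) injective up to conversion, which gives the usual generation lemmas. In a fragment,
-- every declared type is well sorted by induction on a rank of the constants, and every rule
-- preserves typing because the type of its left side is determined up to conversion and its right
-- side can be given that type.

open import Defs
open import Data.Product using (_×_; _,_)
open import Data.List.Membership.Propositional using (_∈_)
open import Relation.Binary.PropositionalEquality using (_≡_)
import Data.List.Relation.Unary.All as All

module Substitution where

  open import Data.Bool using (Bool; true; T; _∧_)
  open import Data.Bool.Properties using (T-∧)
  open import Data.Nat using (ℕ; zero; suc; _<_; _<ᵇ_; s≤s)
  open import Data.Nat.Properties using (<ᵇ⇒<)
  open import Data.Product using (_×_; proj₁; proj₂)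
  open import Function.Bundles using (Equivalence)
  open import Function using (_∘_)
  open import Relation.Binary.PropositionalEquality hiding ([_])

  private variable
    ρ ρ' : ℕ → ℕ
    σ τ : Subst

  ext-cong : ρ ≗ ρ' → ext ρ ≗ ext ρ'
  ext-cong h zero    = refl
  ext-cong h (suc n) = cong suc (h n)

  rename-cong : ρ ≗ ρ' → rename ρ ≗ rename ρ'
  rename-cong h (con c)   = refl
  rename-cong h (var n)   = cong var (h n)
  rename-cong h TYPE      = refl
  rename-cong h KIND      = refl
  rename-cong h (Pi A B)  = cong₂ Pi (rename-cong h A) (rename-cong (ext-cong h) B)
  rename-cong h (lam A t) = cong₂ lam (rename-cong h A) (rename-cong (ext-cong h) t)
  rename-cong h (t · u)   = cong₂ _·_ (rename-cong h t) (rename-cong h u)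

  exts-cong : σ ≗ τ → exts σ ≗ exts τ
  exts-cong h zero    = refl
  exts-cong h (suc n) = cong wk (h n)

  sub-cong : σ ≗ τ → sub σ ≗ sub τ
  sub-cong h (con c)   = refl
  sub-cong h (var n)   = h n
  sub-cong h TYPE      = refl
  sub-cong h KIND      = refl
  sub-cong h (Pi A B)  = cong₂ Pi (sub-cong h A) (sub-cong (exts-cong h) B)
  sub-cong h (lam A t) = cong₂ lam (sub-cong h A) (sub-cong (exts-cong h) t)
  sub-cong h (t · u)   = cong₂ _·_ (sub-cong h t) (sub-cong h u)

  ext-∘ : ∀ (ρ ρ' : ℕ → ℕ) → ext ρ ∘ ext ρ' ≗ ext (ρ ∘ ρ')
  ext-∘ ρ ρ' zero    = refl
  ext-∘ ρ ρ' (suc n) = refl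

  rename-∘ : ∀ (ρ ρ' : ℕ → ℕ) t → rename ρ (rename ρ' t) ≡ rename (ρ ∘ ρ') t
  rename-∘ ρ ρ' (con c)   = refl
  rename-∘ ρ ρ' (var n)   = refl
  rename-∘ ρ ρ' TYPE      = refl
  rename-∘ ρ ρ' KIND      = refl
  rename-∘ ρ ρ' (Pi A B)  =
    cong₂ Pi (rename-∘ ρ ρ' A) (trans (rename-∘ (ext ρ) (ext ρ') B) (rename-cong (ext-∘ ρ ρ') B))
  rename-∘ ρ ρ' (lam A t) =
    cong₂ lam (rename-∘ ρ ρ' A) (trans (rename-∘ (ext ρ) (ext ρ') t) (rename-cong (ext-∘ ρ ρ') t))
  rename-∘ ρ ρ' (t · u)   = cong₂ _·_ (rename-∘ ρ ρ' t) (rename-∘ ρ ρ' u)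

  rename-ext-wk : ∀ (ρ : ℕ → ℕ) t → rename (ext ρ) (wk t) ≡ wk (rename ρ t)
  rename-ext-wk ρ t = trans (rename-∘ (ext ρ) suc t) (sym (rename-∘ suc ρ t))

  rename-ext-exts : ∀ (ρ : ℕ → ℕ) σ → rename (ext ρ) ∘ exts σ ≗ exts (rename ρ ∘ σ)
  rename-ext-exts ρ σ zero    = refl
  rename-ext-exts ρ σ (suc n) = rename-ext-wk ρ (σ n)

  rename-sub : ∀ (ρ : ℕ → ℕ) σ t → rename ρ (sub σ t) ≡ sub (rename ρ ∘ σ) t
  rename-sub ρ σ (con c)   = refl
  rename-sub ρ σ (var n)   = refl
  rename-sub ρ σ TYPE      = refl
  rename-sub ρ σ KIND      = refl
  rename-sub ρ σ (Pi A B)  =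
    cong₂ Pi (rename-sub ρ σ A) (trans (rename-sub (ext ρ) (exts σ) B) (sub-cong (rename-ext-exts ρ σ) B))
  rename-sub ρ σ (lam A t) =
    cong₂ lam (rename-sub ρ σ A) (trans (rename-sub (ext ρ) (exts σ) t) (sub-cong (rename-ext-exts ρ σ) t))
  rename-sub ρ σ (t · u)   = cong₂ _·_ (rename-sub ρ σ t) (rename-sub ρ σ u)

  exts-ext : ∀ σ (ρ : ℕ → ℕ) → exts σ ∘ ext ρ ≗ exts (σ ∘ ρ)
  exts-ext σ ρ zero    = refl
  exts-ext σ ρ (suc n) = refl

  sub-rename : ∀ σ (ρ : ℕ → ℕ) t → sub σ (rename ρ t) ≡ sub (σ ∘ ρ) t
  sub-rename σ ρ (con c)   = refl
  sub-rename σ ρ (var n)   = refl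
  sub-rename σ ρ TYPE      = refl
  sub-rename σ ρ KIND      = refl
  sub-rename σ ρ (Pi A B)  =
    cong₂ Pi (sub-rename σ ρ A) (trans (sub-rename (exts σ) (ext ρ) B) (sub-cong (exts-ext σ ρ) B))
  sub-rename σ ρ (lam A t) =
    cong₂ lam (sub-rename σ ρ A) (trans (sub-rename (exts σ) (ext ρ) t) (sub-cong (exts-ext σ ρ) t))
  sub-rename σ ρ (t · u)   = cong₂ _·_ (sub-rename σ ρ t) (sub-rename σ ρ u)

  sub-exts-wk : ∀ σ t → sub (exts σ) (wk t) ≡ wk (sub σ t)
  sub-exts-wk σ t = trans (sub-rename (exts σ) suc t) (sym (rename-sub suc σ t))

  sub-exts-exts : ∀ σ τ → sub (exts σ) ∘ exts τ ≗ exts (sub σ ∘ τ)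
  sub-exts-exts σ τ zero    = refl
  sub-exts-exts σ τ (suc n) = sub-exts-wk σ (τ n)

  sub-sub : ∀ σ τ t → sub σ (sub τ t) ≡ sub (sub σ ∘ τ) t
  sub-sub σ τ (con c)   = refl
  sub-sub σ τ (var n)   = refl
  sub-sub σ τ TYPE      = refl
  sub-sub σ τ KIND      = refl
  sub-sub σ τ (Pi A B)  =
    cong₂ Pi (sub-sub σ τ A) (trans (sub-sub (exts σ) (exts τ) B) (sub-cong (sub-exts-exts σ τ) B))
  sub-sub σ τ (lam A t) =
    cong₂ lam (sub-sub σ τ A) (trans (sub-sub (exts σ) (exts τ) t) (sub-cong (sub-exts-exts σ τ) t))
  sub-sub σ τ (t · u)   = cong₂ _·_ (sub-sub σ τ t) (sub-sub σ τ u)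

  exts-var : exts var ≗ var
  exts-var zero    = refl
  exts-var (suc n) = refl

  sub-var : ∀ t → sub var t ≡ t
  sub-var (con c)   = refl
  sub-var (var n)   = refl
  sub-var TYPE      = refl
  sub-var KIND      = refl
  sub-var (Pi A B)  = cong₂ Pi (sub-var A) (trans (sub-cong exts-var B) (sub-var B))
  sub-var (lam A t) = cong₂ lam (sub-var A) (trans (sub-cong exts-var t) (sub-var t))
  sub-var (t · u)   = cong₂ _·_ (sub-var t) (sub-var u)

  rename-as-sub : ∀ (ρ : ℕ → ℕ) t → rename ρ t ≡ sub (var ∘ ρ) t
  rename-as-sub ρ t = trans (sym (sub-var (rename ρ t))) (sub-rename var ρ t)

  wk-[] : ∀ t u → wk t [ u ] ≡ t
  wk-[] t u = trans (sub-rename (single u) suc t) (sub-var t)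

  sub-[] : ∀ σ t u → sub σ (t [ u ]) ≡ sub (exts σ) t [ sub σ u ]
  sub-[] σ t u = begin
    sub σ (t [ u ])                          ≡⟨ sub-sub σ (single u) t ⟩
    sub (sub σ ∘ single u) t                 ≡⟨ sub-cong single-exts t ⟩
    sub (sub (single (sub σ u)) ∘ exts σ) t  ≡⟨ sub-sub (single (sub σ u)) (exts σ) t ⟨
    sub (exts σ) t [ sub σ u ]               ∎
    where
    open ≡-Reasoning
    single-exts : sub σ ∘ single u ≗ sub (single (sub σ u)) ∘ exts σ
    single-exts zero    = refl
    single-exts (suc n) = sym (wk-[] (σ n) (sub σ u))

  rename-[] : ∀ (ρ : ℕ → ℕ) t u → rename ρ (t [ u ]) ≡ rename (ext ρ) t [ rename ρ u ]
  rename-[] ρ t u = begin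
    rename ρ (t [ u ])                        ≡⟨ rename-as-sub ρ (t [ u ]) ⟩
    sub (var ∘ ρ) (t [ u ])                   ≡⟨ sub-[] (var ∘ ρ) t u ⟩
    sub (exts (var ∘ ρ)) t [ sub (var ∘ ρ) u ] ≡⟨ cong₂ _[_] (sub-cong exts-var∘ t) (sym (rename-as-sub ρ u)) ⟩
    sub (var ∘ ext ρ) t [ rename ρ u ]        ≡⟨ cong (_[ rename ρ u ]) (rename-as-sub (ext ρ) t) ⟨
    rename (ext ρ) t [ rename ρ u ]           ∎
    where
    open ≡-Reasoning
    exts-var∘ : exts (var ∘ ρ) ≗ var ∘ ext ρ
    exts-var∘ zero    = refl
    exts-var∘ (suc n) = refl

  scoped : ℕ → Tm → Bool
  scoped k (con c)   = true
  scoped k (var n)   = n <ᵇ k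
  scoped k TYPE      = true
  scoped k KIND      = true
  scoped k (Pi A B)  = scoped k A ∧ scoped (suc k) B
  scoped k (lam A t) = scoped k A ∧ scoped (suc k) t
  scoped k (t · u)   = scoped k t ∧ scoped k u

  ∧-split : ∀ {a b} → T (a ∧ b) → T a × T b
  ∧-split = Equivalence.to T-∧

  exts-agree-below : ∀ {k σ τ} → (∀ n → n < k → σ n ≡ τ n) → ∀ n → n < suc k → exts σ n ≡ exts τ n
  exts-agree-below h zero    _        = refl
  exts-agree-below h (suc n) (s≤s lt) = cong wk (h n lt)

  scoped-sub : ∀ k t {σ τ} → T (scoped k t) → (∀ n → n < k → σ n ≡ τ n) → sub σ t ≡ sub τ t
  scoped-sub k (con c)   sc h = refl
  scoped-sub k (var n)   sc h = h n (<ᵇ⇒< n k sc)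
  scoped-sub k TYPE      sc h = refl
  scoped-sub k KIND      sc h = refl
  scoped-sub k (Pi A B)  sc h =
    cong₂ Pi (scoped-sub k A (proj₁ (∧-split sc)) h) (scoped-sub (suc k) B (proj₂ (∧-split sc)) (exts-agree-below h))
  scoped-sub k (lam A t) sc h =
    cong₂ lam (scoped-sub k A (proj₁ (∧-split sc)) h) (scoped-sub (suc k) t (proj₂ (∧-split sc)) (exts-agree-below h))
  scoped-sub k (t · u)   sc h =
    cong₂ _·_ (scoped-sub k t (proj₁ (∧-split sc)) h) (scoped-sub k u (proj₂ (∧-split sc)) h)

  closed-sub : ∀ t σ → T (scoped 0 t) → sub σ t ≡ t
  closed-sub t σ sc = trans (scoped-sub 0 t sc λ _ ()) (sub-var t)

  wkⁿ : ℕ → Tm → Tm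
  wkⁿ zero    t = t
  wkⁿ (suc k) t = wk (wkⁿ k t)

  extsⁿ : ℕ → Subst → Subst
  extsⁿ zero    σ = σ
  extsⁿ (suc k) σ = exts (extsⁿ k σ)

  extsⁿ-single-wk : ∀ k u t → sub (extsⁿ k (single u)) (wkⁿ (suc k) t) ≡ wkⁿ k t
  extsⁿ-single-wk zero    u t = wk-[] t u
  extsⁿ-single-wk (suc k) u t = trans (sub-exts-wk (extsⁿ k (single u)) (wkⁿ (suc k) t)) (cong wk (extsⁿ-single-wk k u t))

  wk²-[][] : ∀ t u v → sub (exts (single u)) (wk (wk t)) [ v ] ≡ t
  wk²-[][] t u v = trans (cong (_[ v ]) (extsⁿ-single-wk 1 u t)) (wk-[] t v)

module AbstractRewriting where

  open import Level using (Level)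
  open import Data.Product using (∃; _×_; _,_)
  open import Relation.Binary.Core using (Rel; _⇒_)
  open import Relation.Binary.Construct.Closure.ReflexiveTransitive as Star using (Star; ε; _◅_; _◅◅_)
  open import Relation.Binary.Construct.Closure.Equivalence using (EqClosure)
  open import Relation.Binary.Construct.Closure.Symmetric using (fwd; bwd)
  open import Relation.Binary.Construct.Closure.Equivalence.Properties using (a—↠b⇒a↔b; a—↠b⇒b↔a)
  open import Relation.Binary.Rewriting using (Confluent)

  private variable
    a ℓ ℓ' : Level
    A : Set a

  Joinable : Rel A ℓ → Rel A _
  Joinable _⟶_ b c = ∃ λ d → b ⟶ d × c ⟶ d

  Diamond : Rel A ℓ → Set _
  Diamond _⟶_ = ∀ {a b c} → a ⟶ b → a ⟶ c → Joinable _⟶_ b c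

  module _ {_⟶_ : Rel A ℓ} (◇ : Diamond _⟶_) where

    strip : ∀ {a b c} → a ⟶ b → Star _⟶_ a c → ∃ λ d → Star _⟶_ b d × c ⟶ d
    strip ab ε = _ , ε , ab
    strip ab (ab' ◅ b'c) with ◇ ab ab'
    ... | d , bd , b'd with strip b'd b'c
    ... | e , de , ce = e , bd ◅ de , ce

    diamond⇒confluent : Confluent _⟶_
    diamond⇒confluent ε ac = _ , ac , ε
    diamond⇒confluent (ab ◅ bc) ad with strip ab ad
    ... | e , be , de with diamond⇒confluent bc be
    ... | f , cf , ef = f , cf , de ◅ ef

  confluent-sandwich : {_⟶_ : Rel A ℓ} {_⇛_ : Rel A ℓ'} →
                       _⟶_ ⇒ _⇛_ → _⇛_ ⇒ Star _⟶_ → Confluent _⇛_ → Confluent _⟶_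
  confluent-sandwich ⟶⊆⇛ ⇛⊆⟶* conf ab ac with conf (Star.map ⟶⊆⇛ ab) (Star.map ⟶⊆⇛ ac)
  ... | d , bd , cd = d , Star.concat (Star.map ⇛⊆⟶* bd) , Star.concat (Star.map ⇛⊆⟶* cd)

  confluent⇒church-rosser : {_⟶_ : Rel A ℓ} → Confluent _⟶_ →
                            ∀ {a b} → EqClosure _⟶_ a b → Joinable (Star _⟶_) a b
  confluent⇒church-rosser conf ε = _ , ε , ε
  confluent⇒church-rosser conf (fwd ab ◅ bc) with confluent⇒church-rosser conf bc
  ... | d , bd , cd = d , ab ◅ bd , cd
  confluent⇒church-rosser conf (bwd ba ◅ bc) with confluent⇒church-rosser conf bc
  ... | d , bd , cd with conf (ba ◅ ε) bd
  ... | e , ae , de = e , ae , cd ◅◅ de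

  joinable⇒eqClosure : {_⟶_ : Rel A ℓ} → ∀ {a b} → Joinable (Star _⟶_) a b → EqClosure _⟶_ a b
  joinable⇒eqClosure (_ , ac , bc) = a—↠b⇒a↔b ac ◅◅ a—↠b⇒b↔a bc

module Constants where

  open import Data.Nat using (ℕ; zero; suc)
  open import Data.Nat.Properties using (eq?)
  open import Data.List using (List; []; _∷_)
  open import Data.Sum using (inj₁; inj₂; [_,_]′)
  open import Function.Bundles using (mk↣)
  open import Relation.Binary.Definitions using (DecidableEquality)
  open import Relation.Binary.PropositionalEquality hiding ([_])
  open import Relation.Nullary.Decidable using (Dec; no; map′; _⊎-dec_)

  constants : List Const
  constants =
    cI ∷ cSet ∷ cEl ∷ cι ∷ cProp ∷ cPrf ∷ cImp ∷ cAll ∷ cTop ∷ cBot ∷ cNeg ∷ cAnd ∷ cOr ∷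
    cEx ∷ cPrfc ∷ cImpc ∷ cAndc ∷ cOrc ∷ cAllc ∷ cExc ∷ co ∷ cArrS ∷ cArrSd ∷ cImpd ∷ cπ ∷
    c0 ∷ cSucc ∷ cPred ∷ cPositive ∷ cPsub ∷ cPair ∷ cPair† ∷ cFst ∷ cSnd ∷ cSet1 ∷ cset ∷
    cArrd1 ∷ cTy ∷ cScheme ∷ cEls ∷ c↑ ∷ cSA ∷ cPA ∷ []

  cnum : Const → ℕ
  cnum cI = 0
  cnum cSet = 1
  cnum cEl = 2
  cnum cι = 3
  cnum cProp = 4
  cnum cPrf = 5
  cnum cImp = 6
  cnum cAll = 7
  cnum cTop = 8
  cnum cBot = 9
  cnum cNeg = 10
  cnum cAnd = 11
  cnum cOr = 12
  cnum cEx = 13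
  cnum cPrfc = 14
  cnum cImpc = 15
  cnum cAndc = 16
  cnum cOrc = 17
  cnum cAllc = 18
  cnum cExc = 19
  cnum co = 20
  cnum cArrS = 21
  cnum cArrSd = 22
  cnum cImpd = 23
  cnum cπ = 24
  cnum c0 = 25
  cnum cSucc = 26
  cnum cPred = 27
  cnum cPositive = 28
  cnum cPsub = 29
  cnum cPair = 30
  cnum cPair† = 31
  cnum cFst = 32
  cnum cSnd = 33
  cnum cSet1 = 34
  cnum cset = 35
  cnum cArrd1 = 36
  cnum cTy = 37
  cnum cScheme = 38
  cnum cEls = 39
  cnum c↑ = 40
  cnum cSA = 41
  cnum cPA = 42

  ofnum : ℕ → Const
  ofnum = nth constants
    where
    nth : List Const → ℕ → Const
    nth []       _       = cI
    nth (c ∷ cs) zero    = c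
    nth (c ∷ cs) (suc n) = nth cs n

  ofnum-cnum : ∀ c → ofnum (cnum c) ≡ c
  ofnum-cnum cI = refl
  ofnum-cnum cSet = refl
  ofnum-cnum cEl = refl
  ofnum-cnum cι = refl
  ofnum-cnum cProp = refl
  ofnum-cnum cPrf = refl
  ofnum-cnum cImp = refl
  ofnum-cnum cAll = refl
  ofnum-cnum cTop = refl
  ofnum-cnum cBot = refl
  ofnum-cnum cNeg = refl
  ofnum-cnum cAnd = refl
  ofnum-cnum cOr = refl
  ofnum-cnum cEx = refl
  ofnum-cnum cPrfc = refl
  ofnum-cnum cImpc = refl
  ofnum-cnum cAndc = refl
  ofnum-cnum cOrc = refl
  ofnum-cnum cAllc = refl
  ofnum-cnum cExc = refl
  ofnum-cnum co = refl
  ofnum-cnum cArrS = refl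
  ofnum-cnum cArrSd = refl
  ofnum-cnum cImpd = refl
  ofnum-cnum cπ = refl
  ofnum-cnum c0 = refl
  ofnum-cnum cSucc = refl
  ofnum-cnum cPred = refl
  ofnum-cnum cPositive = refl
  ofnum-cnum cPsub = refl
  ofnum-cnum cPair = refl
  ofnum-cnum cPair† = refl
  ofnum-cnum cFst = refl
  ofnum-cnum cSnd = refl
  ofnum-cnum cSet1 = refl
  ofnum-cnum cset = refl
  ofnum-cnum cArrd1 = refl
  ofnum-cnum cTy = refl
  ofnum-cnum cScheme = refl
  ofnum-cnum cEls = refl
  ofnum-cnum c↑ = refl
  ofnum-cnum cSA = refl
  ofnum-cnum cPA = refl

  _≟ᶜ_ : DecidableEquality Const
  _≟ᶜ_ = eq? (mk↣ {to = cnum} λ {c} {d} e → trans (sym (ofnum-cnum c)) (trans (cong ofnum e) (ofnum-cnum d)))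

  occurs? : ∀ c t → Dec (Occurs c t)
  occurs? c (con d)   = map′ (λ { refl → here }) (λ { here → refl }) (c ≟ᶜ d)
  occurs? c (var n)   = no λ ()
  occurs? c TYPE      = no λ ()
  occurs? c KIND      = no λ ()
  occurs? c (Pi A B)  = map′ [ piˡ , piʳ ]′ (λ { (piˡ o) → inj₁ o ; (piʳ o) → inj₂ o }) (occurs? c A ⊎-dec occurs? c B)
  occurs? c (lam A t) = map′ [ lamˡ , lamʳ ]′ (λ { (lamˡ o) → inj₁ o ; (lamʳ o) → inj₂ o }) (occurs? c A ⊎-dec occurs? c t)
  occurs? c (t · u)   = map′ [ appˡ , appʳ ]′ (λ { (appˡ o) → inj₁ o ; (appʳ o) → inj₂ o }) (occurs? c t ⊎-dec occurs? c u)

module Patterns where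

  open Constants
  open import Data.Bool using (Bool; true; false; T; not; _∨_)
  open import Data.Empty using (⊥-elim)
  open import Data.Nat using (ℕ; suc; _+_; _<_; _≤_; _<?_; s≤s; z≤n)
  open import Data.Nat.Properties
    using (≤-refl; ≤-trans; ≤-antisym; ≤-pred; <-irrefl; <-≤-trans; <⇒≤; ≮⇒≥; +-comm; +-assoc; +-identityʳ; m<m+n; m≤m+n; m≤n+m)
  open import Data.Product using (_×_; _,_; proj₁; proj₂)
  open import Data.Sum using (_⊎_; inj₁; inj₂)
  open import Relation.Binary.PropositionalEquality hiding ([_])
  open import Relation.Nullary using (¬_; yes; no; does)
  open import Relation.Nullary.Decidable using (dec-true)

  data Pat : Set where
    hole : Pat
    pc   : Const → Pat
    _p·_ : Pat → Pat → Pat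

  infixl 9 _p·_

  holes : Pat → ℕ
  holes hole     = 1
  holes (pc c)   = 0
  holes (p p· q) = holes p + holes q

  -- The holes of ⌊ p ⌋ o are the variables o, o + 1, … from left to right.
  ⌊_⌋_ : Pat → ℕ → Tm
  ⌊ hole ⌋ o   = var o
  ⌊ pc c ⌋ o   = con c
  ⌊ p p· q ⌋ o = ⌊ p ⌋ o · ⌊ q ⌋ (o + holes p)

  toRule : Pat × Tm → Rule
  toRule (p , r) = ⌊ p ⌋ 0 ↪ r

  isHole : Pat → Bool
  isHole hole = true
  isHole _    = false

  _∈[_,_⟩ : ℕ → ℕ → ℕ → Set
  n ∈[ a , b ⟩ = a ≤ n × n < b

  ∈[o,o+1⟩ : ∀ o → o ∈[ o , o + 1 ⟩
  ∈[o,o+1⟩ o = ≤-refl , m<m+n o (s≤s z≤n)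

  ∈[o,o+1⟩⇒≡ : ∀ {n o} → n ∈[ o , o + 1 ⟩ → n ≡ o
  ∈[o,o+1⟩⇒≡ {n} {o} (o≤n , n<o+1) = ≤-antisym (≤-pred (subst (n <_) (+-comm o 1) n<o+1)) o≤n

  ∉[o,o+0⟩ : ∀ {n o} → ¬ n ∈[ o , o + 0 ⟩
  ∉[o,o+0⟩ {n} {o} (o≤n , n<o) = <-irrefl refl (<-≤-trans (subst (n <_) (+-identityʳ o) n<o) o≤n)

  ∈[⟩-split : ∀ {n} o a b → n ∈[ o , o + (a + b) ⟩ → n ∈[ o , o + a ⟩ ⊎ n ∈[ o + a , o + a + b ⟩
  ∈[⟩-split {n} o a b (o≤n , n<) with n <? o + a
  ... | yes lt = inj₁ (o≤n , lt)
  ... | no nlt = inj₂ (≮⇒≥ nlt , subst (n <_) (sym (+-assoc o a b)) n<)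

  ∈[⟩-left : ∀ {n} o a b → n ∈[ o , o + a ⟩ → n ∈[ o , o + (a + b) ⟩
  ∈[⟩-left o a b (o≤n , n<) = o≤n , <-≤-trans n< (subst (o + a ≤_) (+-assoc o a b) (m≤m+n (o + a) b))

  ∈[⟩-right : ∀ {n} o a b → n ∈[ o + a , o + a + b ⟩ → n ∈[ o , o + (a + b) ⟩
  ∈[⟩-right {n} o a b (oa≤n , n<) = ≤-trans (m≤m+n o a) oa≤n , subst (n <_) (+-assoc o a b) n<

  pattern-agree : ∀ p o {θ θ'} → (∀ n → n ∈[ o , o + holes p ⟩ → θ n ≡ θ' n) →
                  sub θ (⌊ p ⌋ o) ≡ sub θ' (⌊ p ⌋ o)
  pattern-agree hole     o h = h o (∈[o,o+1⟩ o)
  pattern-agree (pc c)   o h = refl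
  pattern-agree (p p· q) o h =
    cong₂ _·_ (pattern-agree p o λ n r → h n (∈[⟩-left o (holes p) (holes q) r))
              (pattern-agree q (o + holes p) λ n r → h n (∈[⟩-right o (holes p) (holes q) r))

  ·-injective : ∀ {t u t' u'} → t · u ≡ t' · u' → t ≡ t' × u ≡ u'
  ·-injective refl = refl , refl

  pattern-inj : ∀ p o {θ θ'} → sub θ (⌊ p ⌋ o) ≡ sub θ' (⌊ p ⌋ o) →
                ∀ n → n ∈[ o , o + holes p ⟩ → θ n ≡ θ' n
  pattern-inj hole     o e n r with ∈[o,o+1⟩⇒≡ r
  ... | refl = e
  pattern-inj (pc c)   o e n r = ⊥-elim (∉[o,o+0⟩ r)
  pattern-inj (p p· q) o e n r with ∈[⟩-split o (holes p) (holes q) r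
  ... | inj₁ r' = pattern-inj p o (proj₁ (·-injective e)) n r'
  ... | inj₂ r' = pattern-inj q (o + holes p) (proj₂ (·-injective e)) n r'

  size : Tm → ℕ
  size (con c)   = 1
  size (var n)   = 1
  size TYPE      = 1
  size KIND      = 1
  size (Pi A B)  = suc (size A + size B)
  size (lam A t) = suc (size A + size t)
  size (t · u)   = suc (size t + size u)

  left< : ∀ {m n f} → suc (m + n) ≤ f → m < f
  left< {m} {n} lt = ≤-trans (s≤s (m≤m+n m n)) lt

  right< : ∀ {m n f} → suc (m + n) ≤ f → n < f
  right< {m} {n} lt = ≤-trans (s≤s (m≤n+m n m)) lt

  arg< : ∀ t u {f} → size (t · u) ≤ f → size u < f
  arg< t u = right< {size t}

  body< : ∀ A t u {f} → size (lam A t · u) ≤ f → size t < f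
  body< A t u lt = right< {size A} (<⇒≤ (left< {size (lam A t)} lt))

  hole-size< : ∀ p o θ n → T (not (isHole p)) → n ∈[ o , o + holes p ⟩ → size (θ n) < size (sub θ (⌊ p ⌋ o))

  hole-size≤ : ∀ p o θ n → n ∈[ o , o + holes p ⟩ → size (θ n) ≤ size (sub θ (⌊ p ⌋ o))
  hole-size≤ hole     o θ n r with ∈[o,o+1⟩⇒≡ r
  ... | refl = ≤-refl
  hole-size≤ (pc c)   o θ n r = ⊥-elim (∉[o,o+0⟩ r)
  hole-size≤ (p p· q) o θ n r = <⇒≤ (hole-size< (p p· q) o θ n _ r)

  hole-size< (pc c)   o θ n _ r = ⊥-elim (∉[o,o+0⟩ r)
  hole-size< (p p· q) o θ n _ r with ∈[⟩-split o (holes p) (holes q) r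
  ... | inj₁ r' = s≤s (≤-trans (hole-size≤ p o θ n r') (m≤m+n _ _))
  ... | inj₂ r' = s≤s (≤-trans (hole-size≤ q (o + holes p) θ n r') (m≤n+m _ _))

  apart : Pat → Pat → Bool
  apart (pc c)   (pc d)     = not (does (c ≟ᶜ d))
  apart (pc c)   (_ p· _)   = true
  apart (_ p· _) (pc d)     = true
  apart (p p· q) (p' p· q') = apart p p' ∨ apart q q'
  apart _        _          = false

  apart-sound : ∀ p p' → T (apart p p') → ∀ o o' θ θ' → sub θ (⌊ p ⌋ o) ≢ sub θ' (⌊ p' ⌋ o')
  apart-sound (pc c)   (pc .c)    a o o' θ θ' refl rewrite dec-true (c ≟ᶜ c) refl = a
  apart-sound (p p· q) (p' p· q') a o o' θ θ' e with apart p p' in app'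
  ... | true  = apart-sound p p' (subst T (sym app') _) o o' θ θ' (proj₁ (·-injective e))
  ... | false = apart-sound q q' a (o + holes p) (o' + holes p') θ θ' (proj₂ (·-injective e))

module Reduction (R : Rules) where

  open Substitution
  open import Data.Bool using (T)
  open import Data.Nat using (ℕ; zero; suc; _<_; s≤s)
  open import Data.Nat.Properties using (<ᵇ⇒<)
  open import Data.Product using (proj₁; proj₂)
  open import Data.List.Membership.Propositional using (_∈_)
  open import Function using (_∘_)
  open import Relation.Binary.PropositionalEquality hiding ([_])
  open import Relation.Binary.Construct.Closure.ReflexiveTransitive as Star using (ε; _◅_; _◅◅_)
  import Relation.Binary.Construct.Closure.Equivalence as EqClosure

  ↪-sub : ∀ σ {t s} → R ⊢ t ↪βR s → R ⊢ sub σ t ↪βR sub σ s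
  ↪-sub σ (rule {ρ} m θ) = subst₂ (R ⊢_↪βR_) (sym (sub-sub σ θ (lhs ρ))) (sym (sub-sub σ θ (rhs ρ))) (rule m (sub σ ∘ θ))
  ↪-sub σ (beta {A} {t} {u}) = subst (R ⊢ sub σ (lam A t · u) ↪βR_) (sym (sub-[] σ t u)) beta
  ↪-sub σ (piˡ d)  = piˡ (↪-sub σ d)
  ↪-sub σ (piʳ d)  = piʳ (↪-sub (exts σ) d)
  ↪-sub σ (lamˡ d) = lamˡ (↪-sub σ d)
  ↪-sub σ (lamʳ d) = lamʳ (↪-sub (exts σ) d)
  ↪-sub σ (appˡ d) = appˡ (↪-sub σ d)
  ↪-sub σ (appʳ d) = appʳ (↪-sub σ d)

  ↪-rename : ∀ (ρ : ℕ → ℕ) {t s} → R ⊢ t ↪βR s → R ⊢ rename ρ t ↪βR rename ρ s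
  ↪-rename ρ {t} {s} d = subst₂ (R ⊢_↪βR_) (sym (rename-as-sub ρ t)) (sym (rename-as-sub ρ s)) (↪-sub (var ∘ ρ) d)

  ↪*-Pi : ∀ {A A' B B'} → R ⊢ A ↪* A' → R ⊢ B ↪* B' → R ⊢ Pi A B ↪* Pi A' B'
  ↪*-Pi {A' = A'} {B = B} a b = Star.gmap (λ X → Pi X B) piˡ a ◅◅ Star.gmap (Pi A') piʳ b

  ↪*-lam : ∀ {A A' t t'} → R ⊢ A ↪* A' → R ⊢ t ↪* t' → R ⊢ lam A t ↪* lam A' t'
  ↪*-lam {A' = A'} {t = t} a b = Star.gmap (λ X → lam X t) lamˡ a ◅◅ Star.gmap (lam A') lamʳ b

  ↪*-app : ∀ {t t' u u'} → R ⊢ t ↪* t' → R ⊢ u ↪* u' → R ⊢ (t · u) ↪* (t' · u')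
  ↪*-app {t' = t'} {u = u} a b = Star.gmap (_· u) appˡ a ◅◅ Star.gmap (t' ·_) appʳ b

  ↪*-exts : ∀ {σ σ'} → (∀ n → R ⊢ σ n ↪* σ' n) → ∀ n → R ⊢ exts σ n ↪* exts σ' n
  ↪*-exts h zero    = ε
  ↪*-exts h (suc n) = Star.gmap wk (↪-rename suc) (h n)

  ↪*-sub : ∀ {σ σ'} → (∀ n → R ⊢ σ n ↪* σ' n) → ∀ t → R ⊢ sub σ t ↪* sub σ' t
  ↪*-sub h (con c)   = ε
  ↪*-sub h (var n)   = h n
  ↪*-sub h TYPE      = ε
  ↪*-sub h KIND      = ε
  ↪*-sub h (Pi A B)  = ↪*-Pi (↪*-sub h A) (↪*-sub (↪*-exts h) B)
  ↪*-sub h (lam A t) = ↪*-lam (↪*-sub h A) (↪*-sub (↪*-exts h) t)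
  ↪*-sub h (t · u)   = ↪*-app (↪*-sub h t) (↪*-sub h u)

  ≡βR-sub : ∀ σ {A B} → R ⊢ A ≡βR B → R ⊢ sub σ A ≡βR sub σ B
  ≡βR-sub σ = EqClosure.gmap (sub σ) (↪-sub σ)

  ≡βR-rename : ∀ (ρ : ℕ → ℕ) {A B} → R ⊢ A ≡βR B → R ⊢ rename ρ A ≡βR rename ρ B
  ≡βR-rename ρ = EqClosure.gmap (rename ρ) (↪-rename ρ)

  ≡βR-appʳ : ∀ {t u u'} → R ⊢ u ≡βR u' → R ⊢ (t · u) ≡βR (t · u')
  ≡βR-appʳ {t} = EqClosure.gmap (t ·_) appʳ

  infix 4 _⇛_
  data _⇛_ : Tm → Tm → Set where
    pvar  : ∀ {n} → var n ⇛ var n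
    pcon  : ∀ {c} → con c ⇛ con c
    pTYPE : TYPE ⇛ TYPE
    pKIND : KIND ⇛ KIND
    ppi   : ∀ {A A' B B'} → A ⇛ A' → B ⇛ B' → Pi A B ⇛ Pi A' B'
    plam  : ∀ {A A' t t'} → A ⇛ A' → t ⇛ t' → lam A t ⇛ lam A' t'
    papp  : ∀ {t t' u u'} → t ⇛ t' → u ⇛ u' → t · u ⇛ t' · u'
    pbeta : ∀ {A t t' u u'} → t ⇛ t' → u ⇛ u' → lam A t · u ⇛ t' [ u' ]
    prule : ∀ {ρ θ θ' t s} → ρ ∈ R → (∀ n → θ n ⇛ θ' n) → t ≡ sub θ (lhs ρ) → s ≡ sub θ' (rhs ρ) → t ⇛ s

  ⇛-refl : ∀ t → t ⇛ t
  ⇛-refl (con c)   = pcon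
  ⇛-refl (var n)   = pvar
  ⇛-refl TYPE      = pTYPE
  ⇛-refl KIND      = pKIND
  ⇛-refl (Pi A B)  = ppi (⇛-refl A) (⇛-refl B)
  ⇛-refl (lam A t) = plam (⇛-refl A) (⇛-refl t)
  ⇛-refl (t · u)   = papp (⇛-refl t) (⇛-refl u)

  ⇛-rename : ∀ (ρ : ℕ → ℕ) {t t'} → t ⇛ t' → rename ρ t ⇛ rename ρ t'
  ⇛-rename ρ pvar       = pvar
  ⇛-rename ρ pcon       = pcon
  ⇛-rename ρ pTYPE      = pTYPE
  ⇛-rename ρ pKIND      = pKIND
  ⇛-rename ρ (ppi a b)  = ppi (⇛-rename ρ a) (⇛-rename (ext ρ) b)
  ⇛-rename ρ (plam a b) = plam (⇛-rename ρ a) (⇛-rename (ext ρ) b)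
  ⇛-rename ρ (papp a b) = papp (⇛-rename ρ a) (⇛-rename ρ b)
  ⇛-rename ρ (pbeta {A} {t} {t'} {u} {u'} a b) =
    subst (rename ρ (lam A t · u) ⇛_) (sym (rename-[] ρ t' u')) (pbeta (⇛-rename (ext ρ) a) (⇛-rename ρ b))
  ⇛-rename ρ (prule {r} {θ} {θ'} m h refl refl) =
    prule m (⇛-rename ρ ∘ h) (rename-sub ρ θ (lhs r)) (rename-sub ρ θ' (rhs r))

  ⇛-exts : ∀ {σ σ'} → (∀ n → σ n ⇛ σ' n) → ∀ n → exts σ n ⇛ exts σ' n
  ⇛-exts h zero    = pvar
  ⇛-exts h (suc n) = ⇛-rename suc (h n)

  ⇛-sub : ∀ {σ σ' t t'} → (∀ n → σ n ⇛ σ' n) → t ⇛ t' → sub σ t ⇛ sub σ' t'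
  ⇛-sub h (pvar {n})  = h n
  ⇛-sub h pcon        = pcon
  ⇛-sub h pTYPE       = pTYPE
  ⇛-sub h pKIND       = pKIND
  ⇛-sub h (ppi a b)   = ppi (⇛-sub h a) (⇛-sub (⇛-exts h) b)
  ⇛-sub h (plam a b)  = plam (⇛-sub h a) (⇛-sub (⇛-exts h) b)
  ⇛-sub h (papp a b)  = papp (⇛-sub h a) (⇛-sub h b)
  ⇛-sub {σ} {σ'} h (pbeta {A} {t} {t'} {u} {u'} a b) =
    subst (sub σ (lam A t · u) ⇛_) (sym (sub-[] σ' t' u')) (pbeta (⇛-sub (⇛-exts h) a) (⇛-sub h b))
  ⇛-sub {σ} {σ'} h (prule {r} {θ} {θ'} m h' refl refl) =
    prule m (λ n → ⇛-sub h (h' n)) (sub-sub σ θ (lhs r)) (sub-sub σ' θ' (rhs r))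

  ⇛-[] : ∀ {t t' u u'} → t ⇛ t' → u ⇛ u' → t [ u ] ⇛ t' [ u' ]
  ⇛-[] a b = ⇛-sub (λ { zero → b ; (suc n) → pvar }) a

  ↪⇒⇛ : ∀ {t s} → R ⊢ t ↪βR s → t ⇛ s
  ↪⇒⇛ (rule m θ)                = prule m (⇛-refl ∘ θ) refl refl
  ↪⇒⇛ (beta {t = t} {u})        = pbeta (⇛-refl t) (⇛-refl u)
  ↪⇒⇛ (piˡ {B = B} d)           = ppi (↪⇒⇛ d) (⇛-refl B)
  ↪⇒⇛ (piʳ {A} d)               = ppi (⇛-refl A) (↪⇒⇛ d)
  ↪⇒⇛ (lamˡ {t = t} d)          = plam (↪⇒⇛ d) (⇛-refl t)
  ↪⇒⇛ (lamʳ {A} d)              = plam (⇛-refl A) (↪⇒⇛ d)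
  ↪⇒⇛ (appˡ {u = u} d)          = papp (↪⇒⇛ d) (⇛-refl u)
  ↪⇒⇛ (appʳ {t} d)              = papp (⇛-refl t) (↪⇒⇛ d)

  ⇛⇒↪* : ∀ {t s} → t ⇛ s → R ⊢ t ↪* s
  ⇛⇒↪* pvar       = ε
  ⇛⇒↪* pcon       = ε
  ⇛⇒↪* pTYPE      = ε
  ⇛⇒↪* pKIND      = ε
  ⇛⇒↪* (ppi a b)  = ↪*-Pi (⇛⇒↪* a) (⇛⇒↪* b)
  ⇛⇒↪* (plam a b) = ↪*-lam (⇛⇒↪* a) (⇛⇒↪* b)
  ⇛⇒↪* (papp a b) = ↪*-app (⇛⇒↪* a) (⇛⇒↪* b)
  ⇛⇒↪* (pbeta a b) = ↪*-app (↪*-lam ε (⇛⇒↪* a)) (⇛⇒↪* b) ◅◅ beta ◅ ε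
  ⇛⇒↪* (prule {ρ} {θ} m h refl refl) = rule m θ ◅ ↪*-sub (⇛⇒↪* ∘ h) (rhs ρ)

  ⇛-exts-below : ∀ {k α β} → (∀ n → n < k → α n ⇛ β n) → ∀ n → n < suc k → exts α n ⇛ exts β n
  ⇛-exts-below h zero    _        = pvar
  ⇛-exts-below h (suc n) (s≤s lt) = ⇛-rename suc (h n lt)

  scoped-⇛ : ∀ k r {α β} → T (scoped k r) → (∀ n → n < k → α n ⇛ β n) → sub α r ⇛ sub β r
  scoped-⇛ k (con c)   sc h = pcon
  scoped-⇛ k (var n)   sc h = h n (<ᵇ⇒< n k sc)
  scoped-⇛ k TYPE      sc h = pTYPE
  scoped-⇛ k KIND      sc h = pKIND
  scoped-⇛ k (Pi A B)  sc h = ppi (scoped-⇛ k A (proj₁ (∧-split sc)) h) (scoped-⇛ (suc k) B (proj₂ (∧-split sc)) (⇛-exts-below h))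
  scoped-⇛ k (lam A t) sc h = plam (scoped-⇛ k A (proj₁ (∧-split sc)) h) (scoped-⇛ (suc k) t (proj₂ (∧-split sc)) (⇛-exts-below h))
  scoped-⇛ k (t · u)   sc h = papp (scoped-⇛ k t (proj₁ (∧-split sc)) h) (scoped-⇛ k u (proj₂ (∧-split sc)) h)

module OrthogonalRewriting where

  open Substitution
  open Patterns
  open AbstractRewriting
  open import Data.Bool using (Bool; true; T; not; _∧_)
  open import Data.Empty using (⊥-elim)
  open import Data.Nat using (ℕ; suc; _+_; _≤_; _<_; _<?_; _≟_; s≤s; z≤n)
  open import Data.Nat.Properties using (≤-refl; ≤-pred; <-≤-trans; <-irrefl)
  open import Data.Product using (∃; ∃₂; _×_; _,_; proj₁; proj₂)
  open import Data.Sum using (_⊎_; inj₁; inj₂)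
  open import Data.List using (List; []; _∷_; map)
  import Data.Bool.ListAction as List
  open import Data.List.Membership.Propositional using (_∈_)
  open import Data.List.Membership.Propositional.Properties using (∈-map⁻)
  open import Data.List.Relation.Unary.Any using (here; there)
  import Data.List.Relation.Unary.All as All
  open import Data.List.Relation.Unary.All.Properties using (all⁺)
  open import Function using (_∘_)
  open import Relation.Binary.PropositionalEquality hiding ([_])
  open import Relation.Binary.Construct.Closure.ReflexiveTransitive using (ε; _◅_; _◅◅_)
  open import Relation.Binary.Rewriting using (Confluent)
  open import Relation.Nullary using (¬_; yes; no)


  pairwiseApart : List (Pat × Tm) → Bool
  pairwiseApart []       = true
  pairwiseApart (e ∷ es) = List.all (apart (proj₁ e) ∘ proj₁) es ∧ pairwiseApart es

  module OrthogonalityCheck (Ps : List (Pat × Tm)) where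

    -- No instance of an inert pattern is a redex at its root; holes count as inert since
    -- reductions inside hole fillers are accounted for separately.
    inert : Pat → Bool
    inert hole = true
    inert p    = List.all (apart p ∘ proj₁) Ps

    -- No left side overlaps a proper subpattern, and application heads are never holes.
    innerInert : Pat → Bool
    innerInert (p p· q) = not (isHole p) ∧ inert p ∧ inert q ∧ innerInert p ∧ innerInert q
    innerInert _        = true

    ruleOK : Pat × Tm → Bool
    ruleOK (p , r) = not (isHole p) ∧ innerInert p ∧ scoped (holes p) r

    orthogonal : Bool
    orthogonal = List.all ruleOK Ps ∧ pairwiseApart Ps

  open OrthogonalityCheck public

  pairwiseApart-sound : ∀ es → T (pairwiseApart es) → ∀ {e e'} → e ∈ es → e' ∈ es →
                        e ≡ e' ⊎ T (apart (proj₁ e) (proj₁ e')) ⊎ T (apart (proj₁ e') (proj₁ e))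
  pairwiseApart-sound (e ∷ es) ok (here refl) (here refl) = inj₁ refl
  pairwiseApart-sound (e ∷ es) ok (here refl) (there m')  = inj₂ (inj₁ (All.lookup (all⁺ _ es (proj₁ (∧-split ok))) m'))
  pairwiseApart-sound (e ∷ es) ok (there m)   (here refl) = inj₂ (inj₂ (All.lookup (all⁺ _ es (proj₁ (∧-split ok))) m))
  pairwiseApart-sound (e ∷ es) ok (there m)   (there m')  = pairwiseApart-sound es (proj₂ (∧-split ok)) m m'

  data ConOrApp : Tm → Set where
    con : ∀ {c} → ConOrApp (con c)
    app : ∀ {t u} → ConOrApp (t · u)

  instance-ConOrApp : ∀ p o θ → T (not (isHole p)) → ConOrApp (sub θ (⌊ p ⌋ o))
  instance-ConOrApp (pc c)   o θ _ = con
  instance-ConOrApp (p p· q) o θ _ = app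

  ConOrApp-lam : ∀ {t A b} → ConOrApp t → t ≢ lam A b
  ConOrApp-lam con ()
  ConOrApp-lam app ()

  ConOrApp-Pi : ∀ {t A B} → ConOrApp t → t ≢ Pi A B
  ConOrApp-Pi con ()
  ConOrApp-Pi app ()

  module Orthogonal (Ps : List (Pat × Tm)) (orth : T (orthogonal Ps))
                    (R : Rules) (R⊆Ps : ∀ ρ → ρ ∈ R → ρ ∈ map toRule Ps) where

    open Reduction R

    rule-entry : ∀ {ρ} → ρ ∈ R → ∃ λ e → e ∈ Ps × ρ ≡ toRule e
    rule-entry m = ∈-map⁻ toRule (R⊆Ps _ m)

    entry-ok : ∀ {p r} → (p , r) ∈ Ps → T (not (isHole p)) × T (innerInert Ps p) × T (scoped (holes p) r)
    entry-ok {p} m =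
      let nh , ok = ∧-split {not (isHole p)} (All.lookup (all⁺ _ Ps (proj₁ (∧-split orth))) m) in
      nh , ∧-split ok

    lhs-unique : ∀ {e e' θ θ'} → e ∈ Ps → e' ∈ Ps →
                 sub θ (⌊ proj₁ e ⌋ 0) ≡ sub θ' (⌊ proj₁ e' ⌋ 0) → e ≡ e'
    lhs-unique {e} {e'} {θ} {θ'} m m' eq with pairwiseApart-sound Ps (proj₂ (∧-split orth)) m m'
    ... | inj₁ e≡e'      = e≡e'
    ... | inj₂ (inj₁ ap) = ⊥-elim (apart-sound (proj₁ e) (proj₁ e') ap 0 0 θ θ' eq)
    ... | inj₂ (inj₂ ap) = ⊥-elim (apart-sound (proj₁ e') (proj₁ e) ap 0 0 θ' θ (sym eq))

    lhs-ConOrApp : ∀ {ρ} → ρ ∈ R → ∀ θ → ConOrApp (sub θ (lhs ρ))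
    lhs-ConOrApp m θ with rule-entry m
    ... | (p , r) , me , refl = instance-ConOrApp p 0 θ (proj₁ (entry-ok me))

    RootStep : Tm → Tm → Set
    RootStep t s = ∃ λ ρ → ∃₂ λ θ θ' → ρ ∈ R × (∀ n → θ n ⇛ θ' n) × t ≡ sub θ (lhs ρ) × s ≡ sub θ' (rhs ρ)

    InstanceReduct : Pat → ℕ → Subst → Tm → Set
    InstanceReduct p o θ s = ∃ λ θ' → (∀ n → θ n ⇛ θ' n) × s ≡ sub θ' (⌊ p ⌋ o)

    hole-reduct : ∀ o {θ s} → θ o ⇛ s → InstanceReduct hole o θ s
    hole-reduct o {θ} {s} d = θ' , θ⇛θ' , sym θ'o≡s
      where
      θ' : Subst
      θ' n with n ≟ o
      ... | yes _ = s
      ... | no  _ = θ n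
      θ'o≡s : θ' o ≡ s
      θ'o≡s with o ≟ o
      ... | yes _  = refl
      ... | no o≢o = ⊥-elim (o≢o refl)
      θ⇛θ' : ∀ n → θ n ⇛ θ' n
      θ⇛θ' n with n ≟ o
      ... | yes refl = d
      ... | no  _    = ⇛-refl (θ n)

    app-reduct : ∀ p q o {θ s₁ s₂} → InstanceReduct p o θ s₁ → InstanceReduct q (o + holes p) θ s₂ →
                 InstanceReduct (p p· q) o θ (s₁ · s₂)
    app-reduct p q o {θ} (θ₁ , θ⇛θ₁ , refl) (θ₂ , θ⇛θ₂ , refl) =
      θ' , θ⇛θ' ,
      cong₂ _·_ (pattern-agree p o λ n (_ , n<) → sym (θ'-below n n<))
                (pattern-agree q (o + holes p) λ n (≤n , _) → sym (θ'-above n ≤n))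
      where
      θ' : Subst
      θ' n with n <? o + holes p
      ... | yes _ = θ₁ n
      ... | no  _ = θ₂ n
      θ⇛θ' : ∀ n → θ n ⇛ θ' n
      θ⇛θ' n with n <? o + holes p
      ... | yes _ = θ⇛θ₁ n
      ... | no  _ = θ⇛θ₂ n
      θ'-below : ∀ n → n < o + holes p → θ' n ≡ θ₁ n
      θ'-below n n< with n <? o + holes p
      ... | yes _ = refl
      ... | no  ≮ = ⊥-elim (≮ n<)
      θ'-above : ∀ n → o + holes p ≤ n → θ' n ≡ θ₂ n
      θ'-above n ≤n with n <? o + holes p
      ... | yes n< = ⊥-elim (<-irrefl refl (<-≤-trans n< ≤n))
      ... | no  _  = refl

    inert-no-root : ∀ p o {θ s} → T (not (isHole p)) → T (inert Ps p) → ¬ RootStep (sub θ (⌊ p ⌋ o)) s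
    inert-no-root p o {θ} nh ip (ρ , θ₁ , _ , m , _ , eq , _) with rule-entry m
    ... | (p₁ , r₁) , me , refl = apart-sound p p₁ (All.lookup (all⁺ _ Ps (inert-all p nh ip)) me) o 0 θ θ₁ eq
      where
      inert-all : ∀ p → T (not (isHole p)) → T (inert Ps p) → T (List.all (apart p ∘ proj₁) Ps)
      inert-all (pc c)   _ ip = ip
      inert-all (p p· q) _ ip = ip

    innerInert-app : ∀ p q → T (innerInert Ps (p p· q)) →
                     T (not (isHole p)) × T (inert Ps p) × T (inert Ps q) × T (innerInert Ps p) × T (innerInert Ps q)
    innerInert-app p q ok =
      let a , ok₁ = ∧-split {not (isHole p)} ok
          b , ok₂ = ∧-split {inert Ps p} ok₁
          c , ok₃ = ∧-split {inert Ps q} ok₂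
          d , e   = ∧-split {innerInert Ps p} ok₃
      in a , b , c , d , e

    mutual
      ⇛-instance : ∀ p o {θ t s} → T (innerInert Ps p) → t ⇛ s → sub θ (⌊ p ⌋ o) ≡ t →
                   InstanceReduct p o θ s ⊎ RootStep t s
      ⇛-instance hole     o _ d refl = inj₁ (hole-reduct o d)
      ⇛-instance (pc c)   o {θ} _ pcon refl = inj₁ (θ , ⇛-refl ∘ θ , refl)
      ⇛-instance (pc c)   o _ (prule m h e₁ e₂) _ = inj₂ (_ , _ , _ , m , h , e₁ , e₂)
      ⇛-instance (p p· q) o _ (prule m h e₁ e₂) _ = inj₂ (_ , _ , _ , m , h , e₁ , e₂)
      ⇛-instance (p p· q) o ok (papp d₁ d₂) refl =
        let _ , ip , iq , okp , okq = innerInert-app p q ok in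
        inj₁ (app-reduct p q o (⇛-inert-instance p o okp ip d₁ refl) (⇛-inert-instance q (o + holes p) okq iq d₂ refl))
      ⇛-instance (p p· q) o {θ} ok (pbeta _ _) eq =
        ⊥-elim (ConOrApp-lam (instance-ConOrApp p o θ (proj₁ (innerInert-app p q ok))) (proj₁ (·-injective eq)))

      ⇛-inert-instance : ∀ p o {θ t s} → T (innerInert Ps p) → T (inert Ps p) → t ⇛ s → sub θ (⌊ p ⌋ o) ≡ t →
                         InstanceReduct p o θ s
      ⇛-inert-instance hole o _ _ d refl = hole-reduct o d
      ⇛-inert-instance (pc c) o {θ} {s = s} ok ip d eq with ⇛-instance (pc c) o ok d eq
      ... | inj₁ red  = red
      ... | inj₂ root = ⊥-elim (inert-no-root (pc c) o {θ} _ ip (subst (λ t → RootStep t s) (sym eq) root))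
      ⇛-inert-instance (p p· q) o {θ} {s = s} ok ip d eq with ⇛-instance (p p· q) o ok d eq
      ... | inj₁ red  = red
      ... | inj₂ root = ⊥-elim (inert-no-root (p p· q) o {θ} _ ip (subst (λ t → RootStep t s) (sym eq) root))

    joinSubst : ∀ k {α β : Subst} → (∀ n → n < k → Joinable _⇛_ (α n) (β n)) → Subst → Subst
    joinSubst k J δ n with n <? k
    ... | yes n<k = proj₁ (J n n<k)
    ... | no  _   = δ n

    joinSubst-left : ∀ k {α β : Subst} J δ n → n < k → α n ⇛ joinSubst k {α} {β} J δ n
    joinSubst-left k J δ n n<k with n <? k
    ... | yes n<k' = proj₁ (proj₂ (J n n<k'))
    ... | no  n≮k  = ⊥-elim (n≮k n<k)

    joinSubst-right : ∀ k {α β : Subst} J δ n → n < k → β n ⇛ joinSubst k {α} {β} J δ n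
    joinSubst-right k J δ n n<k with n <? k
    ... | yes n<k' = proj₂ (proj₂ (J n n<k'))
    ... | no  n≮k  = ⊥-elim (n≮k n<k)

    joinSubst-right-default : ∀ k {α β : Subst} J n → β n ⇛ joinSubst k {α} {β} J β n
    joinSubst-right-default k {β = β} J n with n <? k
    ... | yes n<k = proj₂ (proj₂ (J n n<k))
    ... | no  _   = ⇛-refl (β n)

    DiamondBelow : ℕ → Set
    DiamondBelow f = ∀ {t s₁ s₂} → size t < f → t ⇛ s₁ → t ⇛ s₂ → Joinable _⇛_ s₁ s₂

    -- Left-linearity lets the reducts of the hole fillers be joined independently, and since left
    -- sides do not overlap, the other reduction is either inside the fillers or the same rule step.
    root-diamond : ∀ {f t s₁ s₂ ρ θ θ'} → DiamondBelow f → size t ≤ f → ρ ∈ R → (∀ n → θ n ⇛ θ' n) →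
                   t ≡ sub θ (lhs ρ) → s₁ ≡ sub θ' (rhs ρ) → t ⇛ s₂ → Joinable _⇛_ s₁ s₂
    root-diamond {f} {t} {s₁} {s₂} {ρ} {θ} {θ'} IH t≤f m θ⇛θ' refl refl t⇛s₂ with rule-entry m
    ... | (p , r) , me , refl with entry-ok me
    ... | nh , okp , sc with ⇛-instance p 0 okp t⇛s₂ refl
    ... | inj₁ (θ₂ , θ⇛θ₂ , refl) = sub σ r , scoped-⇛ (holes p) r sc (joinSubst-left (holes p) {θ'} {θ₂} joins θ₂) ,
                                    prule m (joinSubst-right-default (holes p) {θ'} {θ₂} joins) refl refl
      where
      joins : ∀ n → n < holes p → Joinable _⇛_ (θ' n) (θ₂ n)
      joins n n<k = IH (<-≤-trans (hole-size< p 0 θ n nh (z≤n , n<k)) t≤f) (θ⇛θ' n) (θ⇛θ₂ n)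
      σ : Subst
      σ = joinSubst (holes p) {θ'} {θ₂} joins θ₂
    ... | inj₂ (ρ₂ , θ₁ , θ₁' , m₂ , θ₁⇛θ₁' , eq₁ , refl) with rule-entry m₂
    ... | e₂ , me₂ , refl with lhs-unique me me₂ eq₁
    ... | refl = sub σ r , scoped-⇛ (holes p) r sc (joinSubst-left (holes p) {θ'} {θ₁'} joins θ') ,
                           scoped-⇛ (holes p) r sc (joinSubst-right (holes p) {θ'} {θ₁'} joins θ')
      where
      joins : ∀ n → n < holes p → Joinable _⇛_ (θ' n) (θ₁' n)
      joins n n<k = IH (<-≤-trans (hole-size< p 0 θ n nh (z≤n , n<k)) t≤f) (θ⇛θ' n)
                   (subst (_⇛ θ₁' n) (sym (pattern-inj p 0 eq₁ n (z≤n , n<k))) (θ₁⇛θ₁' n))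
      σ : Subst
      σ = joinSubst (holes p) {θ'} {θ₁'} joins θ'

    ⇛-lam-inv : ∀ {t X A b} → t ⇛ X → t ≡ lam A b → ∃₂ λ A' b' → X ≡ lam A' b' × b ⇛ b'
    ⇛-lam-inv (plam _ d) refl = _ , _ , refl , d
    ⇛-lam-inv (prule {θ = θ} m _ eq _) refl = ⊥-elim (ConOrApp-lam (lhs-ConOrApp m θ) (sym eq))

    join-cong : ∀ {F : Tm → Tm → Tm} {a₁ a₂ b₁ b₂} →
                (∀ {a a' b b'} → a ⇛ a' → b ⇛ b' → F a b ⇛ F a' b') →
                Joinable _⇛_ a₁ a₂ → Joinable _⇛_ b₁ b₂ → Joinable _⇛_ (F a₁ b₁) (F a₂ b₂)
    join-cong F⇛ (a , x₁ , x₂) (b , y₁ , y₂) = _ , F⇛ x₁ y₁ , F⇛ x₂ y₂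

    ⇛-diamond-below : ∀ f → DiamondBelow f
    ⇛-diamond-below (suc f) t<f (prule m h e₁ e₂) d = root-diamond (⇛-diamond-below f) (≤-pred t<f) m h e₁ e₂ d
    ⇛-diamond-below (suc f) t<f d (prule m h e₁ e₂) =
      let w , a , b = root-diamond (⇛-diamond-below f) (≤-pred t<f) m h e₁ e₂ d in w , b , a
    ⇛-diamond-below (suc f) t<f pvar  pvar  = _ , pvar , pvar
    ⇛-diamond-below (suc f) t<f pcon  pcon  = _ , pcon , pcon
    ⇛-diamond-below (suc f) t<f pTYPE pTYPE = _ , pTYPE , pTYPE
    ⇛-diamond-below (suc f) t<f pKIND pKIND = _ , pKIND , pKIND
    ⇛-diamond-below (suc f) (s≤s lt) (ppi a b) (ppi a' b') =
      join-cong ppi (⇛-diamond-below f (left< lt) a a') (⇛-diamond-below f (right< lt) b b')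
    ⇛-diamond-below (suc f) (s≤s lt) (plam a b) (plam a' b') =
      join-cong plam (⇛-diamond-below f (left< lt) a a') (⇛-diamond-below f (right< lt) b b')
    ⇛-diamond-below (suc f) (s≤s lt) (papp a b) (papp a' b') =
      join-cong papp (⇛-diamond-below f (left< lt) a a') (⇛-diamond-below f (right< lt) b b')
    ⇛-diamond-below (suc f) (s≤s lt) (papp a b) (pbeta {A} {t} {_} {u} c d) with ⇛-lam-inv a refl
    ... | _ , _ , refl , a' =
      let w₁ , x₁ , y₁ = ⇛-diamond-below f (body< A t u lt) a' c
          w₂ , x₂ , y₂ = ⇛-diamond-below f (arg< (lam A t) u lt) b d
      in w₁ [ w₂ ] , pbeta x₁ x₂ , ⇛-[] y₁ y₂
    ⇛-diamond-below (suc f) (s≤s lt) (pbeta {A} {t} {_} {u} c d) (papp a b) with ⇛-lam-inv a refl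
    ... | _ , _ , refl , a' =
      let w₁ , x₁ , y₁ = ⇛-diamond-below f (body< A t u lt) c a'
          w₂ , x₂ , y₂ = ⇛-diamond-below f (arg< (lam A t) u lt) d b
      in w₁ [ w₂ ] , ⇛-[] x₁ x₂ , pbeta y₁ y₂
    ⇛-diamond-below (suc f) (s≤s lt) (pbeta {A} {t} {_} {u} a b) (pbeta c d) =
      let w₁ , x₁ , y₁ = ⇛-diamond-below f (body< A t u lt) a c
          w₂ , x₂ , y₂ = ⇛-diamond-below f (arg< (lam A t) u lt) b d
      in w₁ [ w₂ ] , ⇛-[] x₁ x₂ , ⇛-[] y₁ y₂

    ⇛-diamond : Diamond _⇛_
    ⇛-diamond {t} = ⇛-diamond-below (suc (size t)) ≤-refl

    ↪-confluent : Confluent (R ⊢_↪βR_)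
    ↪-confluent = confluent-sandwich ↪⇒⇛ ⇛⇒↪* (diamond⇒confluent ⇛-diamond)

    ≡βR-joinable : ∀ {t u} → R ⊢ t ≡βR u → Joinable (R ⊢_↪*_) t u
    ≡βR-joinable = confluent⇒church-rosser ↪-confluent

    ⇛-Pi-inv : ∀ {t X A B} → t ⇛ X → t ≡ Pi A B → ∃₂ λ A' B' → X ≡ Pi A' B' × A ⇛ A' × B ⇛ B'
    ⇛-Pi-inv (ppi a b) refl = _ , _ , refl , a , b
    ⇛-Pi-inv (prule {θ = θ} m _ eq _) refl = ⊥-elim (ConOrApp-Pi (lhs-ConOrApp m θ) (sym eq))

    ↪*-Pi-inv : ∀ {A B X} → R ⊢ Pi A B ↪* X → ∃₂ λ A' B' → X ≡ Pi A' B' × R ⊢ A ↪* A' × R ⊢ B ↪* B'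
    ↪*-Pi-inv ε = _ , _ , refl , ε , ε
    ↪*-Pi-inv (d ◅ ds) with ⇛-Pi-inv (↪⇒⇛ d) refl
    ... | _ , _ , refl , a , b with ↪*-Pi-inv ds
    ... | A' , B' , eq , a' , b' = A' , B' , eq , ⇛⇒↪* a ◅◅ a' , ⇛⇒↪* b ◅◅ b'

    Pi-injective : ∀ {A B A' B'} → R ⊢ Pi A B ≡βR Pi A' B' → (R ⊢ A ≡βR A') × (R ⊢ B ≡βR B')
    Pi-injective c with ≡βR-joinable c
    ... | _ , x , y with ↪*-Pi-inv x | ↪*-Pi-inv y
    ... | _ , _ , refl , a , b | _ , _ , refl , a' , b' =
      joinable⇒eqClosure (_ , a , a') , joinable⇒eqClosure (_ , b , b')

    ↪*-inert-instance : ∀ p o {θ X} → T (innerInert Ps p) → T (inert Ps p) → R ⊢ sub θ (⌊ p ⌋ o) ↪* X →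
                        ∃ λ θ' → X ≡ sub θ' (⌊ p ⌋ o) × ∀ n → R ⊢ θ n ↪* θ' n
    ↪*-inert-instance p o {θ} ok ip ε = θ , refl , λ _ → ε
    ↪*-inert-instance p o ok ip (d ◅ ds) with ⇛-inert-instance p o ok ip (↪⇒⇛ d) refl
    ... | θ₁ , θ⇛θ₁ , refl with ↪*-inert-instance p o ok ip ds
    ... | θ₂ , eq , θ₁↪*θ₂ = θ₂ , eq , λ n → ⇛⇒↪* (θ⇛θ₁ n) ◅◅ θ₁↪*θ₂ n

    inert-injective : ∀ p {θ θ'} → T (innerInert Ps p) → T (inert Ps p) →
                      R ⊢ sub θ (⌊ p ⌋ 0) ≡βR sub θ' (⌊ p ⌋ 0) → ∀ n → n < holes p → R ⊢ θ n ≡βR θ' n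
    inert-injective p {θ' = θ'} ok ip c n n<k with ≡βR-joinable c
    ... | _ , x , y with ↪*-inert-instance p 0 ok ip x | ↪*-inert-instance p 0 ok ip y
    ... | θ₁ , refl , h₁ | θ₂ , eq , h₂ =
      joinable⇒eqClosure (θ₁ n , h₁ n , subst (R ⊢ θ' n ↪*_) (sym (pattern-inj p 0 eq n (z≤n , n<k))) (h₂ n))

module Typing (Sig : Signature) (R : Rules)
  (decl-closed : ∀ {c A} → (c , A) ∈ Sig → ∀ σ → sub σ A ≡ A)
  (decl-unique : ∀ {c A A'} → (c , A) ∈ Sig → (c , A') ∈ Sig → A ≡ A')
  (Pi-injective : ∀ {A B A' B'} → R ⊢ Pi A B ≡βR Pi A' B' → (R ⊢ A ≡βR A') × (R ⊢ B ≡βR B')) where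

  open Substitution
  open Reduction R using (≡βR-sub; ≡βR-rename)
  open import Relation.Binary.PropositionalEquality hiding ([_])
  open import Data.Nat using (ℕ; zero; suc)
  open import Data.Product using (∃; ∃₂; proj₁; proj₂)
  open import Data.Sum using (_⊎_; inj₁; inj₂)
  open import Data.Empty using (⊥; ⊥-elim)
  open import Data.List using (_∷_)
  open import Function using (_∘_; id)
  open import Relation.Nullary using (¬_)
  open import Relation.Binary.Construct.Closure.Equivalence using (symmetric)
  open import Relation.Binary.Construct.Closure.ReflexiveTransitive using (ε; _◅◅_)

  infix 4 _⊢_∶_
  _⊢_∶_ : Ctx → Tm → Tm → Set
  Γ ⊢ t ∶ A = Ty Sig R Γ t A

  ⊢_ : Ctx → Set
  ⊢ Γ = WF Sig R Γ

  ⊢-≡ : ∀ {Γ t A B} → A ≡ B → Γ ⊢ t ∶ A → Γ ⊢ t ∶ B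
  ⊢-≡ refl d = d

  ≡βR-sym : ∀ {A B} → R ⊢ A ≡βR B → R ⊢ B ≡βR A
  ≡βR-sym = symmetric _

  sort-rename : ∀ {s} → IsSort s → ∀ (ρ : ℕ → ℕ) → rename ρ s ≡ s
  sort-rename sTYPE ρ = refl
  sort-rename sKIND ρ = refl

  sort-sub : ∀ {s} → IsSort s → ∀ σ → sub σ s ≡ s
  sort-sub sTYPE σ = refl
  sort-sub sKIND σ = refl

  decl-closed-rename : ∀ {c A} → (c , A) ∈ Sig → ∀ (ρ : ℕ → ℕ) → rename ρ A ≡ A
  decl-closed-rename m ρ = trans (rename-as-sub ρ _) (decl-closed m (var ∘ ρ))

  ⊢-ext : ∀ {Γ A} → Γ ⊢ A ∶ TYPE → ⊢ (A ∷ Γ)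
  ⊢-ext = decl sTYPE

  ⊢-ctx : ∀ {Γ t A} → Γ ⊢ t ∶ A → ⊢ Γ
  ⊢-ctx (sort w)         = w
  ⊢-ctx (const w _ _ _)  = w
  ⊢-ctx (var w _)        = w
  ⊢-ctx (prod _ a _)     = ⊢-ctx a
  ⊢-ctx (abs _ a _ _)    = ⊢-ctx a
  ⊢-ctx (app a _)        = ⊢-ctx a
  ⊢-ctx (conv a _ _ _)   = ⊢-ctx a

  Renaming : (ℕ → ℕ) → Ctx → Ctx → Set
  Renaming ρ Γ Δ = ∀ {x A} → Γ ∋ x ⦂ A → Δ ∋ ρ x ⦂ rename ρ A

  Renaming-ext : ∀ {ρ Γ Δ A} → Renaming ρ Γ Δ → Renaming (ext ρ) (A ∷ Γ) (rename ρ A ∷ Δ)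
  Renaming-ext {ρ} {Δ = Δ} {A} r here =
    subst ((rename ρ A ∷ Δ) ∋ 0 ⦂_) (sym (rename-ext-wk ρ A)) here
  Renaming-ext {ρ} {Δ = Δ} {A} r (there {A = B} {n = n} i) =
    subst ((rename ρ A ∷ Δ) ∋ suc (ρ n) ⦂_) (sym (rename-ext-wk ρ B)) (there (r i))

  ⊢-rename : ∀ {Γ Δ t A ρ} → ⊢ Δ → Renaming ρ Γ Δ → Γ ⊢ t ∶ A → Δ ⊢ rename ρ t ∶ rename ρ A
  ⊢-rename w r (sort _) = sort w
  ⊢-rename {ρ = ρ} w r (const _ s d m) = ⊢-≡ (sym (decl-closed-rename m ρ)) (const w s d m)
  ⊢-rename w r (var _ i) = var w (r i)
  ⊢-rename {ρ = ρ} w r (prod s a b) =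
    let a' = ⊢-rename w r a in
    ⊢-≡ (sym (sort-rename s ρ))
      (prod s a' (⊢-≡ (sort-rename s (ext ρ)) (⊢-rename (⊢-ext a') (Renaming-ext r) b)))
  ⊢-rename {ρ = ρ} w r (abs s a b t) =
    let a' = ⊢-rename w r a in
    abs s a' (⊢-≡ (sort-rename s (ext ρ)) (⊢-rename (⊢-ext a') (Renaming-ext r) b))
             (⊢-rename (⊢-ext a') (Renaming-ext r) t)
  ⊢-rename {ρ = ρ} w r (app {u = u} {B = B} a b) =
    ⊢-≡ (sym (rename-[] ρ B u)) (app (⊢-rename w r a) (⊢-rename w r b))
  ⊢-rename {ρ = ρ} w r (conv a s b c) =
    conv (⊢-rename w r a) s (⊢-≡ (sort-rename s ρ) (⊢-rename w r b)) (≡βR-rename ρ c)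

  ⊢-wk : ∀ {Γ t A B} → ⊢ (B ∷ Γ) → Γ ⊢ t ∶ A → (B ∷ Γ) ⊢ wk t ∶ wk A
  ⊢-wk w = ⊢-rename w there

  Substitution : Subst → Ctx → Ctx → Set
  Substitution σ Γ Δ = ∀ {x A} → Γ ∋ x ⦂ A → Δ ⊢ σ x ∶ sub σ A

  Substitution-exts : ∀ {σ Γ Δ A} → ⊢ (sub σ A ∷ Δ) → Substitution σ Γ Δ →
                      Substitution (exts σ) (A ∷ Γ) (sub σ A ∷ Δ)
  Substitution-exts {σ} {A = A} w s here = ⊢-≡ (sym (sub-exts-wk σ A)) (var w here)
  Substitution-exts {σ} w s (there {A = B} i) = ⊢-≡ (sym (sub-exts-wk σ B)) (⊢-wk w (s i))

  ⊢-sub : ∀ {Γ Δ t A σ} → ⊢ Δ → Substitution σ Γ Δ → Γ ⊢ t ∶ A → Δ ⊢ sub σ t ∶ sub σ A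
  ⊢-sub w s (sort _) = sort w
  ⊢-sub {σ = σ} w s (const _ k d m) = ⊢-≡ (sym (decl-closed m σ)) (const w k d m)
  ⊢-sub w s (var _ i) = s i
  ⊢-sub {σ = σ} w s (prod k a b) =
    let a' = ⊢-sub w s a ; w' = ⊢-ext a' in
    ⊢-≡ (sym (sort-sub k σ))
      (prod k a' (⊢-≡ (sort-sub k (exts σ)) (⊢-sub w' (Substitution-exts w' s) b)))
  ⊢-sub {σ = σ} w s (abs k a b t) =
    let a' = ⊢-sub w s a ; w' = ⊢-ext a' in
    abs k a' (⊢-≡ (sort-sub k (exts σ)) (⊢-sub w' (Substitution-exts w' s) b))
             (⊢-sub w' (Substitution-exts w' s) t)
  ⊢-sub {σ = σ} w s (app {u = u} {B = B} a b) =
    ⊢-≡ (sym (sub-[] σ B u)) (app (⊢-sub w s a) (⊢-sub w s b))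
  ⊢-sub {σ = σ} w s (conv a k b c) =
    conv (⊢-sub w s a) k (⊢-≡ (sort-sub k σ) (⊢-sub w s b)) (≡βR-sub σ c)

  ⊢-[] : ∀ {Γ A t B u} → (A ∷ Γ) ⊢ t ∶ B → Γ ⊢ u ∶ A → Γ ⊢ t [ u ] ∶ B [ u ]
  ⊢-[] {Γ} {A} {u = u} d du = ⊢-sub (⊢-ctx du) single-typed d
    where
    single-typed : Substitution (single u) (A ∷ Γ) Γ
    single-typed here = ⊢-≡ (sym (wk-[] A u)) du
    single-typed (there {A = B} i) = ⊢-≡ (sym (wk-[] B u)) (var (⊢-ctx du) i)

  ⊢-arr : ∀ {Γ A B s} → IsSort s → Γ ⊢ A ∶ TYPE → Γ ⊢ B ∶ s → Γ ⊢ arr A B ∶ s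
  ⊢-arr k a b = prod k a (⊢-≡ (sort-rename k suc) (⊢-wk (⊢-ext a) b))

  Pi-gen : ∀ {Γ A B T} → Γ ⊢ Pi A B ∶ T → Γ ⊢ A ∶ TYPE × ∃ λ s → IsSort s × (A ∷ Γ) ⊢ B ∶ s
  Pi-gen (prod k a b)     = a , _ , k , b
  Pi-gen (conv d _ _ _)   = Pi-gen d

  ∋-sorted : ∀ {Γ x A} → ⊢ Γ → Γ ∋ x ⦂ A → ∃ λ s → IsSort s × Γ ⊢ A ∶ s
  ∋-sorted (decl k d) here = _ , k , ⊢-≡ (sort-rename k suc) (⊢-wk (decl k d) d)
  ∋-sorted (decl k d) (there i) with ∋-sorted (⊢-ctx d) i
  ... | _ , k' , d' = _ , k' , ⊢-≡ (sort-rename k' suc) (⊢-wk (decl k d) d')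

  validity : ∀ {Γ t A} → Γ ⊢ t ∶ A → A ≡ KIND ⊎ ∃ λ s → IsSort s × Γ ⊢ A ∶ s
  validity (sort w) = inj₁ refl
  validity (const w k d m) =
    inj₂ (_ , k , subst₂ (_ ⊢_∶_) (decl-closed-rename m id) (sort-rename k id) (⊢-rename w (λ ()) d))
  validity (var w i) = inj₂ (∋-sorted w i)
  validity (prod sTYPE a b) = inj₂ (_ , sKIND , sort (⊢-ctx a))
  validity (prod sKIND a b) = inj₁ refl
  validity (abs k a b t) = inj₂ (_ , k , prod k a b)
  validity (app a u) with validity a
  ... | inj₁ ()
  ... | inj₂ (_ , _ , dPi) with Pi-gen dPi
  ... | _ , _ , k , dB = inj₂ (_ , k , ⊢-≡ (sort-sub k _) (⊢-[] dB u))
  validity (conv a k b c) = inj₂ (_ , k , b)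

  KIND-untyped : ∀ {Γ A} → ¬ Γ ⊢ KIND ∶ A
  KIND-untyped (conv d _ _ _) = KIND-untyped d

  app-not-KIND : ∀ {Γ t u} → ¬ Γ ⊢ t · u ∶ KIND
  app-not-KIND d = go d refl
    where
    []-KIND : ∀ B u → B [ u ] ≡ KIND → B ≡ KIND ⊎ u ≡ KIND
    []-KIND KIND          u _ = inj₁ refl
    []-KIND (var zero)    u e = inj₂ e
    []-KIND (var (suc n)) u ()
    []-KIND (con c)       u ()
    []-KIND TYPE          u ()
    []-KIND (Pi _ _)      u ()
    []-KIND (lam _ _)     u ()
    []-KIND (_ · _)       u ()
    go : ∀ {Γ t u T} → Γ ⊢ t · u ∶ T → T ≡ KIND → ⊥
    go (app {u = u} {B = B} a b) e with []-KIND B u e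
    ... | inj₂ refl = KIND-untyped b
    ... | inj₁ refl with validity a
    ... | inj₁ ()
    ... | inj₂ (_ , _ , dPi) = KIND-untyped (proj₂ (proj₂ (proj₂ (Pi-gen dPi))))
    go (conv a k b c) refl = KIND-untyped b

  con-not-KIND : ∀ {Γ c} → ¬ Γ ⊢ con c ∶ KIND
  con-not-KIND d = go d refl
    where
    go : ∀ {Γ c T} → Γ ⊢ con c ∶ T → T ≡ KIND → ⊥
    go (const _ _ d _) refl = KIND-untyped d
    go (conv _ _ b _)  refl = KIND-untyped b

  app-gen : ∀ {Γ t u T} → Γ ⊢ t · u ∶ T → ∃₂ λ A B → Γ ⊢ t ∶ Pi A B × Γ ⊢ u ∶ A × (R ⊢ T ≡βR (B [ u ]))
  app-gen (app a b) = _ , _ , a , b , ε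
  app-gen (conv d _ _ c) with app-gen d
  ... | A , B , a , u , c' = A , B , a , u , ≡βR-sym c ◅◅ c'

  con-gen : ∀ {Γ c T} → Γ ⊢ con c ∶ T → ∃ λ A → (c , A) ∈ Sig × R ⊢ T ≡βR A
  con-gen (const _ _ _ m) = _ , m , ε
  con-gen (conv d _ _ c) with con-gen d
  ... | A , m , c' = A , m , ≡βR-sym c ◅◅ c'

  TypeIs : Ctx → Tm → Tm → Set
  TypeIs Γ t K = ∀ {P} → Γ ⊢ t ∶ P → R ⊢ P ≡βR K

  con-TypeIs : ∀ {Γ c K} → (c , K) ∈ Sig → TypeIs Γ (con c) K
  con-TypeIs m d with con-gen d
  ... | _ , m' , c = subst (R ⊢ _ ≡βR_) (decl-unique m' m) c

  app-TypeIs : ∀ {Γ t u A B} → TypeIs Γ t (Pi A B) → TypeIs Γ (t · u) (B [ u ])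
  app-TypeIs {u = u} kt d with app-gen d
  ... | _ , _ , dt , _ , c = c ◅◅ ≡βR-sub (single u) (proj₂ (Pi-injective (kt dt)))

  fun-typed : ∀ {Γ t u T} → Γ ⊢ t · u ∶ T → ∃ λ P → Γ ⊢ t ∶ P
  fun-typed d with app-gen d
  ... | _ , _ , a , _ , _ = _ , a

  arg-typed : ∀ {Γ t u A B s T} → TypeIs Γ t (Pi A B) → IsSort s → Γ ⊢ A ∶ s → Γ ⊢ t · u ∶ T → Γ ⊢ u ∶ A
  arg-typed kt k dA d with app-gen d
  ... | _ , _ , dt , du , _ = conv du k dA (proj₁ (Pi-injective (kt dt)))

  retype : ∀ {Γ l r K A} → TypeIs Γ l K → ¬ Γ ⊢ l ∶ KIND → Γ ⊢ l ∶ A → Γ ⊢ r ∶ K → Γ ⊢ r ∶ A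
  retype kl nk dl dr with validity dl
  ... | inj₁ refl = ⊥-elim (nk dl)
  ... | inj₂ (_ , k , dA) = conv dr k dA (≡βR-sym (kl dl))

  retype-app : ∀ {Γ t u r A B C} → TypeIs Γ t (Pi A B) → Γ ⊢ t · u ∶ C → Γ ⊢ r ∶ B [ u ] → Γ ⊢ r ∶ C
  retype-app k = retype (app-TypeIs k) app-not-KIND

  retype-con : ∀ {Γ c r K C} → TypeIs Γ (con c) K → Γ ⊢ con c ∶ C → Γ ⊢ r ∶ K → Γ ⊢ r ∶ C
  retype-con k = retype k con-not-KIND

  args₂-typed : ∀ {Γ f x y T A B C} → TypeIs Γ f (Pi A (Pi B C)) → Γ ⊢ A ∶ TYPE →
                (∀ {x} → Γ ⊢ x ∶ A → Γ ⊢ B [ x ] ∶ TYPE) → Γ ⊢ f · x · y ∶ T → Γ ⊢ x ∶ A × Γ ⊢ y ∶ B [ x ]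
  args₂-typed k dA dB d =
    let dx = arg-typed k sTYPE dA (proj₂ (fun-typed d)) in
    dx , arg-typed (app-TypeIs k) sTYPE (dB dx) d

module SystemU where

  open Substitution
  open Constants
  open Patterns
  open OrthogonalRewriting
  open import Data.Bool using (Bool; true; false; T; if_then_else_)
  open import Data.Nat using (ℕ)
  open import Data.Product using (_×_; _,_; proj₂)
  open import Function using (_∘_)
  open import Data.List using (List; []; _∷_; map)
  open import Data.List.Membership.Propositional using (_∈_)
  open import Data.List.Membership.Propositional.Properties using (∈-map⁻)
  import Data.List.Relation.Unary.All as All
  open import Data.List.Relation.Unary.All.Properties using (all⁺)
  open import Relation.Binary.PropositionalEquality hiding ([_])

  private
    v : ℕ → Tm
    v = var
    nn : Tm → Tm
    nn x = neg · (neg · x)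
    h : Pat
    h = hole

  binProp : Tm
  binProp = arr Prop (arr Prop Prop)

  quantTy : Tm → Tm → Tm → Tm
  quantTy D F T = Pi D (arr (arr (F · v 0) T) T)

  typeU : Const → Tm
  typeU cI = TYPE
  typeU cSet = TYPE
  typeU cEl = arr Set' TYPE
  typeU cι = Set'
  typeU cProp = TYPE
  typeU cPrf = arr Prop TYPE
  typeU cImp = binProp
  typeU cAll = quantTy Set' El Prop
  typeU cTop = Prop
  typeU cBot = Prop
  typeU cNeg = arr Prop Prop
  typeU cAnd = binProp
  typeU cOr = binProp
  typeU cEx = quantTy Set' El Prop
  typeU cPrfc = arr Prop TYPE
  typeU cImpc = binProp
  typeU cAndc = binProp
  typeU cOrc = binProp
  typeU cAllc = quantTy Set' El Prop
  typeU cExc = quantTy Set' El Prop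
  typeU co = Set'
  typeU cArrS = arr Set' (arr Set' Set')
  typeU cArrSd = quantTy Set' El Set'
  typeU cImpd = quantTy Prop Prf Prop
  typeU cπ = quantTy Prop Prf Set'
  typeU c0 = I
  typeU cSucc = arr I I
  typeU cPred = arr I I
  typeU cPositive = arr I Prop
  typeU cPsub = Pi Set' (arr (arr (El · v 0) Prop) Set')
  typeU cPair = Pi Set' (Pi (arr (El · v 0) Prop) (Pi (El · v 1) (arr (Prf · (v 1 · v 0)) (El · (psub · v 2 · v 1)))))
  typeU cPair† = Pi Set' (Pi (arr (El · v 0) Prop) (arr (El · v 1) (El · (psub · v 1 · v 0))))
  typeU cFst = Pi Set' (Pi (arr (El · v 0) Prop) (arr (El · (psub · v 1 · v 0)) (El · v 1)))
  typeU cSnd = Pi Set' (Pi (arr (El · v 0) Prop) (Pi (El · (psub · v 1 · v 0)) (Prf · (v 1 · (fst · v 2 · v 1 · v 0)))))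
  typeU cSet1 = TYPE
  typeU cset = SetOne
  typeU cArrd1 = quantTy Set' El SetOne
  typeU cTy = arr SetOne TYPE
  typeU cScheme = TYPE
  typeU cEls = arr Scheme TYPE
  typeU c↑ = arr Set' Scheme
  typeU cSA = arr (arr Set' Scheme) Scheme
  typeU cPA = arr (arr Set' Prop) Prop

  ΣU-tabulates : ΣU ≡ map (λ c → c , typeU c) constants
  ΣU-tabulates = refl

  ΣU-type : ∀ {c A} → (c , A) ∈ ΣU → A ≡ typeU c
  ΣU-type {c} {A} m with ∈-map⁻ (λ c → c , typeU c) (subst ((c , A) ∈_) ΣU-tabulates m)
  ... | _ , _ , refl = refl

  ΣU-closed : ∀ {c A} → (c , A) ∈ ΣU → ∀ σ → sub σ A ≡ A
  ΣU-closed {A = A} m σ = closed-sub A σ (All.lookup (all⁺ (scoped 0 ∘ proj₂) ΣU _) m)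

  RUp : List (Pat × Tm)
  RUp =
    (pc cEl p· pc cι , I) ∷
    (pc cPrf p· (pc cImp p· h p· h) , arr (Prf · v 0) (Prf · v 1)) ∷
    (pc cPrf p· (pc cAll p· h p· h) , Pi (El · v 0) (Prf · (v 2 · v 0))) ∷
    (pc cPrf p· pc cTop , Pi Prop (arr (Prf · v 0) (Prf · v 0))) ∷
    (pc cPrf p· pc cBot , Pi Prop (Prf · v 0)) ∷
    (pc cPrf p· (pc cNeg p· h) , arr (Prf · v 0) (Pi Prop (Prf · v 0))) ∷
    (pc cPrf p· (pc cAnd p· h p· h) ,
       Pi Prop (arr (arr (Prf · v 1) (arr (Prf · v 2) (Prf · v 0))) (Prf · v 0))) ∷
    (pc cPrf p· (pc cOr p· h p· h) ,
       Pi Prop (arr (arr (Prf · v 1) (Prf · v 0))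
                    (arr (arr (Prf · v 2) (Prf · v 0)) (Prf · v 0)))) ∷
    (pc cPrf p· (pc cEx p· h p· h) ,
       Pi Prop (arr (Pi (El · v 1) (arr (Prf · (v 3 · v 0)) (Prf · v 1))) (Prf · v 0))) ∷
    (pc cPrfc , lam Prop (Prf · nn (v 0))) ∷
    (pc cImpc , lam Prop (lam Prop (imp · nn (v 1) · nn (v 0)))) ∷
    (pc cAndc , lam Prop (lam Prop (and · nn (v 1) · nn (v 0)))) ∷
    (pc cOrc , lam Prop (lam Prop (or · nn (v 1) · nn (v 0)))) ∷
    (pc cAllc , lam Set' (lam (arr (El · v 0) Prop)
              (all · v 1 · lam (El · v 1) (nn (v 1 · v 0))))) ∷
    (pc cExc , lam Set' (lam (arr (El · v 0) Prop)
              (ex · v 1 · lam (El · v 1) (nn (v 1 · v 0))))) ∷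
    (pc cEl p· pc co , Prop) ∷
    (pc cEl p· (pc cArrS p· h p· h) , arr (El · v 0) (El · v 1)) ∷
    (pc cEl p· (pc cArrSd p· h p· h) , Pi (El · v 0) (El · (v 2 · v 0))) ∷
    (pc cPrf p· (pc cImpd p· h p· h) , Pi (Prf · v 0) (Prf · (v 2 · v 0))) ∷
    (pc cEl p· (pc cπ p· h p· h) , Pi (Prf · v 0) (El · (v 2 · v 0))) ∷
    (pc cPred p· pc c0 , z) ∷
    (pc cPred p· (pc cSucc p· h) , v 0) ∷
    (pc cPositive p· pc c0 , bot) ∷
    (pc cPositive p· (pc cSucc p· h) , top) ∷
    (pc cPair p· h p· h p· h p· h , pair† · v 0 · v 1 · v 2) ∷
    (pc cFst p· h p· h p· (pc cPair† p· h p· h p· h) , v 4) ∷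
    (pc cTy p· pc cset , Set') ∷
    (pc cTy p· (pc cArrd1 p· h p· h) , Pi (El · v 0) (TyC · (v 2 · v 0))) ∷
    (pc cEls p· (pc c↑ p· h) , El · v 0) ∷
    (pc cEls p· (pc cSA p· h) , Pi Set' (Els · (v 1 · v 0))) ∷
    (pc cPrf p· (pc cPA p· h) , Pi Set' (Prf · (v 1 · v 0))) ∷
    []


  RU-patterns : RU ≡ map toRule RUp
  RU-patterns = refl

  RUp-orthogonal : T (orthogonal RUp)
  RUp-orthogonal = _

  kindTyped : Const → Bool
  kindTyped cI      = true
  kindTyped cSet    = true
  kindTyped cEl     = true
  kindTyped cProp   = true
  kindTyped cPrf    = true
  kindTyped cPrfc   = true
  kindTyped cSet1   = true
  kindTyped cTy     = true
  kindTyped cScheme = true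
  kindTyped cEls    = true
  kindTyped _       = false

  sortU : Const → Tm
  sortU c = if kindTyped c then KIND else TYPE

  sortU-IsSort : ∀ c → IsSort (sortU c)
  sortU-IsSort c = if-IsSort (kindTyped c)
    where
    if-IsSort : ∀ b → IsSort (if b then KIND else TYPE)
    if-IsSort true  = sKIND
    if-IsSort false = sTYPE

  -- The declared type of a constant mentions only constants of smaller rank.
  rank : Const → ℕ
  rank cI      = 0
  rank cSet    = 0
  rank cProp   = 0
  rank cSet1   = 0
  rank cScheme = 0
  rank cAll    = 2
  rank cEx     = 2
  rank cAllc   = 2
  rank cExc    = 2
  rank cArrSd  = 2
  rank cImpd   = 2
  rank cπ      = 2
  rank cPsub   = 2
  rank cArrd1  = 2
  rank cPair   = 3
  rank cPair†  = 3
  rank cFst    = 3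
  rank cSnd    = 4
  rank _       = 1

module Fragment (Sig₁ : Signature) (R₁ : Rules) (F : IsFragment Sig₁ R₁ ΣU RU) where

  open Constants using (occurs?)
  open Patterns using (toRule)
  open SystemU
  open OrthogonalRewriting using (module Orthogonal)
  open import Data.Nat using (suc; _<_; _<?_)
  open import Data.Nat.Properties using (≤-refl; ≤-trans; ≤-pred)
  open import Data.Product using (_,_)
  open import Data.List using ([]; map)
  open import Data.List.Membership.Propositional using (_∈_)
  open import Data.List.Relation.Unary.Any using (here; there)
  open import Relation.Binary.PropositionalEquality hiding ([_])
  open import Relation.Nullary.Decidable using (True; toWitness)

  open IsFragment F

  decl-closed : ∀ {c A} → (c , A) ∈ Sig₁ → ∀ σ → sub σ A ≡ A
  decl-closed m = ΣU-closed (declsSub _ m)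

  decl-unique : ∀ {c A A'} → (c , A) ∈ Sig₁ → (c , A') ∈ Sig₁ → A ≡ A'
  decl-unique m m' = trans (ΣU-type (declsSub _ m)) (sym (ΣU-type (declsSub _ m')))

  rules⊆RUp : ∀ ρ → ρ ∈ R₁ → ρ ∈ map toRule RUp
  rules⊆RUp ρ m = subst (ρ ∈_) RU-patterns (rulesSub ρ m)

  open Orthogonal RUp RUp-orthogonal R₁ rules⊆RUp public
  open Typing Sig₁ R₁ decl-closed decl-unique Pi-injective public

  In : Const → Set
  In c = c ∈∣ Sig₁ ∣

  In-decl : ∀ {c} → In c → (c , typeU c) ∈ Sig₁
  In-decl {c} (A , m) = subst (λ X → (c , X) ∈ Sig₁) (ΣU-type (declsSub _ m)) m

  In-type : ∀ {c} → In c → ∀ d → {True (occurs? d (typeU c))} → In d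
  In-type m d {occ} = typesIn _ _ (In-decl m) d (toWitness occ)

  Everywhere : Tm → Tm → Set
  Everywhere t A = ∀ {Γ} → ⊢ Γ → Γ ⊢ t ∶ A

  ⊢Pi-family : ∀ {d f t₁ t₂} → Everywhere (con d) TYPE → Everywhere (con f) (arr (con d) TYPE) →
               Everywhere (con t₁) TYPE → Everywhere (con t₂) TYPE →
               [] ⊢ Pi (con d) (arr (arr (con f · var 0) (con t₁)) (con t₂)) ∶ TYPE
  ⊢Pi-family dD dF dT₁ dT₂ =
    let dD' = dD empty ; w = ⊢-ext dD'
        dFx = app (dF w) (var w here)
    in prod sTYPE dD' (⊢-arr sTYPE (⊢-arr sTYPE dFx (dT₁ w)) (dT₂ w))

  SmallerTyped : Const → Set
  SmallerTyped c = ∀ d → {True (occurs? d (typeU c))} → {True (rank d <? rank c)} → Everywhere (con d) (typeU d)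

  typeU-sorted : ∀ c → SmallerTyped c → [] ⊢ typeU c ∶ sortU c
  typeU-sorted cI      K = sort empty
  typeU-sorted cSet    K = sort empty
  typeU-sorted cProp   K = sort empty
  typeU-sorted cSet1   K = sort empty
  typeU-sorted cScheme K = sort empty
  typeU-sorted cEl     K = ⊢-arr sKIND (K cSet empty) (sort empty)
  typeU-sorted cPrf    K = ⊢-arr sKIND (K cProp empty) (sort empty)
  typeU-sorted cPrfc   K = ⊢-arr sKIND (K cProp empty) (sort empty)
  typeU-sorted cTy     K = ⊢-arr sKIND (K cSet1 empty) (sort empty)
  typeU-sorted cEls    K = ⊢-arr sKIND (K cScheme empty) (sort empty)
  typeU-sorted cι      K = K cSet empty
  typeU-sorted co      K = K cSet empty
  typeU-sorted cTop    K = K cProp empty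
  typeU-sorted cBot    K = K cProp empty
  typeU-sorted c0      K = K cI empty
  typeU-sorted cset    K = K cSet1 empty
  typeU-sorted cImp    K = ⊢-arr sTYPE (K cProp empty) (⊢-arr sTYPE (K cProp empty) (K cProp empty))
  typeU-sorted cAnd    K = ⊢-arr sTYPE (K cProp empty) (⊢-arr sTYPE (K cProp empty) (K cProp empty))
  typeU-sorted cOr     K = ⊢-arr sTYPE (K cProp empty) (⊢-arr sTYPE (K cProp empty) (K cProp empty))
  typeU-sorted cImpc   K = ⊢-arr sTYPE (K cProp empty) (⊢-arr sTYPE (K cProp empty) (K cProp empty))
  typeU-sorted cAndc   K = ⊢-arr sTYPE (K cProp empty) (⊢-arr sTYPE (K cProp empty) (K cProp empty))
  typeU-sorted cOrc    K = ⊢-arr sTYPE (K cProp empty) (⊢-arr sTYPE (K cProp empty) (K cProp empty))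
  typeU-sorted cArrS   K = ⊢-arr sTYPE (K cSet empty) (⊢-arr sTYPE (K cSet empty) (K cSet empty))
  typeU-sorted cNeg    K = ⊢-arr sTYPE (K cProp empty) (K cProp empty)
  typeU-sorted cSucc   K = ⊢-arr sTYPE (K cI empty) (K cI empty)
  typeU-sorted cPred   K = ⊢-arr sTYPE (K cI empty) (K cI empty)
  typeU-sorted cPositive K = ⊢-arr sTYPE (K cI empty) (K cProp empty)
  typeU-sorted c↑      K = ⊢-arr sTYPE (K cSet empty) (K cScheme empty)
  typeU-sorted cSA     K = ⊢-arr sTYPE (⊢-arr sTYPE (K cSet empty) (K cScheme empty)) (K cScheme empty)
  typeU-sorted cPA     K = ⊢-arr sTYPE (⊢-arr sTYPE (K cSet empty) (K cProp empty)) (K cProp empty)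
  typeU-sorted cAll    K = ⊢Pi-family (K cSet) (K cEl) (K cProp) (K cProp)
  typeU-sorted cEx     K = ⊢Pi-family (K cSet) (K cEl) (K cProp) (K cProp)
  typeU-sorted cAllc   K = ⊢Pi-family (K cSet) (K cEl) (K cProp) (K cProp)
  typeU-sorted cExc    K = ⊢Pi-family (K cSet) (K cEl) (K cProp) (K cProp)
  typeU-sorted cArrSd  K = ⊢Pi-family (K cSet) (K cEl) (K cSet) (K cSet)
  typeU-sorted cImpd   K = ⊢Pi-family (K cProp) (K cPrf) (K cProp) (K cProp)
  typeU-sorted cπ      K = ⊢Pi-family (K cProp) (K cPrf) (K cSet) (K cSet)
  typeU-sorted cArrd1  K = ⊢Pi-family (K cSet) (K cEl) (K cSet1) (K cSet1)
  typeU-sorted cPsub   K = ⊢Pi-family (K cSet) (K cEl) (K cProp) (K cSet)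
  typeU-sorted cPair   K =
    let dS = K cSet empty ; w₁ = ⊢-ext dS
        dE₀ = app (K cEl w₁) (var w₁ here)
        dP = ⊢-arr sTYPE dE₀ (K cProp w₁) ; w₂ = ⊢-ext dP
        dE₁ = app (K cEl w₂) (var w₂ (there here)) ; w₃ = ⊢-ext dE₁
        dPrf = app (K cPrf w₃) (app (var w₃ (there here)) (var w₃ here)) ; w₄ = ⊢-ext dPrf
        dEps = app (K cEl w₄) (app (app (K cPsub w₄) (var w₄ (there (there (there here))))) (var w₄ (there (there here))))
    in prod sTYPE dS (prod sTYPE dP (prod sTYPE dE₁ (prod sTYPE dPrf dEps)))
  typeU-sorted cPair†  K =
    let dS = K cSet empty ; w₁ = ⊢-ext dS
        dE₀ = app (K cEl w₁) (var w₁ here)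
        dP = ⊢-arr sTYPE dE₀ (K cProp w₁) ; w₂ = ⊢-ext dP
        dE₁ = app (K cEl w₂) (var w₂ (there here)) ; w₃ = ⊢-ext dE₁
        dEps = app (K cEl w₃) (app (app (K cPsub w₃) (var w₃ (there (there here)))) (var w₃ (there here)))
    in prod sTYPE dS (prod sTYPE dP (prod sTYPE dE₁ dEps))
  typeU-sorted cFst    K =
    let dS = K cSet empty ; w₁ = ⊢-ext dS
        dE₀ = app (K cEl w₁) (var w₁ here)
        dP = ⊢-arr sTYPE dE₀ (K cProp w₁) ; w₂ = ⊢-ext dP
        dEps = app (K cEl w₂) (app (app (K cPsub w₂) (var w₂ (there here))) (var w₂ here)) ; w₃ = ⊢-ext dEps
    in prod sTYPE dS (prod sTYPE dP (prod sTYPE dEps (app (K cEl w₃) (var w₃ (there (there here))))))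
  typeU-sorted cSnd    K =
    let dS = K cSet empty ; w₁ = ⊢-ext dS
        dE₀ = app (K cEl w₁) (var w₁ here)
        dP = ⊢-arr sTYPE dE₀ (K cProp w₁) ; w₂ = ⊢-ext dP
        dEps = app (K cEl w₂) (app (app (K cPsub w₂) (var w₂ (there here))) (var w₂ here)) ; w₃ = ⊢-ext dEps
        dFst = app (app (app (K cFst w₃) (var w₃ (there (there here)))) (var w₃ (there here))) (var w₃ here)
    in prod sTYPE dS (prod sTYPE dP (prod sTYPE dEps (app (K cPrf w₃) (app (var w₃ (there here)) dFst))))

  con-typed : ∀ f c → rank c < f → In c → Everywhere (con c) (typeU c)
  con-typed (suc f) c r m w =
    const w (sortU-IsSort c)
          (typeU-sorted c λ d {occ} {d<c} → con-typed f d (≤-trans (toWitness d<c) (≤-pred r)) (In-type m d {occ}))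
          (In-decl m)

  ⊢con : ∀ c → In c → Everywhere (con c) (typeU c)
  ⊢con c = con-typed (suc (rank c)) c ≤-refl

  typeU-TypeIs : ∀ {Γ c} → In c → TypeIs Γ (con c) (typeU c)
  typeU-TypeIs m = con-TypeIs (In-decl m)

module SubjectReduction (Sig₁ : Signature) (R₁ : Rules) (F : IsFragment Sig₁ R₁ ΣU RU) where

  open Substitution
  open Constants using (occurs?)
  open SystemU
  open Patterns using (pc; hole; _p·_)
  open Fragment Sig₁ R₁ F
  open Reduction R₁ using (≡βR-appʳ)
  open import Data.Nat using (zero; suc; s≤s; z≤n)
  open import Data.Product using (_×_; _,_; proj₁; proj₂)
  open import Data.List using ([]; _∷_)
  open import Data.List.Membership.Propositional using (_∈_)
  open import Data.List.Relation.Unary.Any using (here; there)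
  open import Data.List.Relation.Unary.All using (All; []; _∷_)
  open import Relation.Binary.PropositionalEquality hiding ([_])
  open import Relation.Nullary.Decidable using (True; toWitness)

  open IsFragment F

  Preserves : Rule → Set
  Preserves ρ = ∀ θ {Γ A} → ρ ∈ R₁ → Γ ⊢ sub θ (lhs ρ) ∶ A → Γ ⊢ sub θ (rhs ρ) ∶ A

  lhs-In : ∀ {ρ} → ρ ∈ R₁ → ∀ c → {True (occurs? c (lhs ρ))} → In c
  lhs-In {ρ} m c {occ} = proj₁ (system ρ m) c (toWitness occ)

  rhs-In : ∀ {ρ} → ρ ∈ R₁ → ∀ c → {True (occurs? c (rhs ρ))} → In c
  rhs-In {ρ} m c {occ} = proj₂ (system ρ m) c (toWitness occ)

  head-arg : ∀ {Γ h x M A} → In h → typeU h ≡ Pi (con x) TYPE → Γ ⊢ con x ∶ TYPE →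
             Γ ⊢ con h · M ∶ A → Γ ⊢ M ∶ con x
  head-arg ih eq = arg-typed (subst (TypeIs _ _) eq (typeU-TypeIs ih)) sTYPE

  quant-args : ∀ {Γ q d f t x y A} → TypeIs Γ (con q) (Pi (con d) (Pi (Pi (con f · var 0) (con t)) (con t))) →
               Γ ⊢ con d ∶ TYPE → Γ ⊢ con f ∶ Pi (con d) TYPE → Γ ⊢ con t ∶ TYPE →
               Γ ⊢ con q · x · y ∶ A → Γ ⊢ x ∶ con d × Γ ⊢ y ∶ Pi (con f · x) (con t)
  quant-args k dD dF dT = args₂-typed k dD (λ dx → ⊢-arr sTYPE (app dF dx) dT)

  ⊢Pi-fiber : ∀ {Γ A y t g} → Γ ⊢ A ∶ TYPE → Γ ⊢ y ∶ Pi A (con t) → Everywhere (con g) (Pi (con t) TYPE) →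
              Γ ⊢ Pi A (con g · (wk y · var 0)) ∶ TYPE
  ⊢Pi-fiber dA dy dG = let w = ⊢-ext dA in prod sTYPE dA (app (dG w) (app (⊢-wk w dy) (var w here)))

  ¬¬-typed : ∀ {Γ x} → In cNeg → Γ ⊢ x ∶ Prop → Γ ⊢ neg · (neg · x) ∶ Prop
  ¬¬-typed i dx = let w = ⊢-ctx dx in app (⊢con cNeg i w) (app (⊢con cNeg i w) dx)

  ⊢classical-connective : ∀ {Γ op} → In op → In cNeg → In cProp → typeU op ≡ binProp → ⊢ Γ →
                          Γ ⊢ lam Prop (lam Prop (con op · (neg · (neg · var 1)) · (neg · (neg · var 0)))) ∶ binProp
  ⊢classical-connective {op = op} iop iNeg iProp eq w =
    let dProp = ⊢con cProp iProp w ; w₁ = ⊢-ext dProp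
        dProp₁ = ⊢con cProp iProp w₁ ; w₂ = ⊢-ext dProp₁
        dop = subst (_ ⊢ con op ∶_) eq (⊢con op iop w₂)
        body = app (app dop (¬¬-typed iNeg (var w₂ (there here)))) (¬¬-typed iNeg (var w₂ here))
    in abs sTYPE dProp (prod sTYPE dProp₁ (⊢con cProp iProp w₂)) (abs sTYPE dProp₁ (⊢con cProp iProp w₂) body)

  ⊢classical-quantifier : ∀ {Γ op} → In op → In cNeg → In cProp → In cSet → In cEl →
                          typeU op ≡ quantTy Set' El Prop → ⊢ Γ →
                          Γ ⊢ lam Set' (lam (arr (El · var 0) Prop)
                                  (con op · var 1 · lam (El · var 1) (neg · (neg · (var 1 · var 0)))))
                              ∶ quantTy Set' El Prop
  ⊢classical-quantifier {op = op} iop iNeg iProp iSet iEl eq w =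
    let dSet = ⊢con cSet iSet w ; w₁ = ⊢-ext dSet
        dE₀ = app (⊢con cEl iEl w₁) (var w₁ here)
        dP = ⊢-arr sTYPE dE₀ (⊢con cProp iProp w₁) ; w₂ = ⊢-ext dP
        dE₁ = app (⊢con cEl iEl w₂) (var w₂ (there here)) ; w₃ = ⊢-ext dE₁
        dBody = abs sTYPE dE₁ (⊢con cProp iProp w₃) (¬¬-typed iNeg (app (var w₃ (there here)) (var w₃ here)))
        dop = subst (_ ⊢ con op ∶_) eq (⊢con op iop w₂)
    in abs sTYPE dSet (prod sTYPE dP (⊢con cProp iProp w₂))
                      (abs sTYPE dP (⊢con cProp iProp w₂) (app (app dop (var w₂ (there here))) dBody))

  El-psub-injective : ∀ {a b a' b'} → R₁ ⊢ (El · (psub · a · b)) ≡βR (El · (psub · a' · b')) → R₁ ⊢ a ≡βR a'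
  El-psub-injective {a} {b} {a'} {b'} c =
    inert-injective (pc cEl p· (pc cPsub p· hole p· hole))
                    {θ = λ { zero → a ; (suc _) → b }} {θ' = λ { zero → a' ; (suc _) → b' }} _ _ c 0 (s≤s z≤n)

  El-psub-≡ : ∀ {a b a' b'} → a ≡ a' → b ≡ b' → El · (psub · a · b) ≡ El · (psub · a' · b')
  El-psub-≡ = cong₂ (λ a b → El · (psub · a · b))

  preserves-El-ι : Preserves (El · ι ↪ I)
  preserves-El-ι _ m d = retype-app (typeU-TypeIs (lhs-In m cEl)) d (⊢con cI (rhs-In m cI) (⊢-ctx d))

  preserves-Prf-⇒ : Preserves (Prf · (imp · var 0 · var 1) ↪ arr (Prf · var 0) (Prf · var 1))
  preserves-Prf-⇒ _ m d =
    let w = ⊢-ctx d ; iPrf = lhs-In m cPrf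
        dProp = ⊢con cProp (In-type iPrf cProp) w
        dx , dy = args₂-typed (typeU-TypeIs (lhs-In m cImp)) dProp (λ _ → dProp)
                              (head-arg iPrf refl dProp d)
    in retype-app (typeU-TypeIs iPrf) d (⊢-arr sTYPE (app (⊢con cPrf iPrf w) dx) (app (⊢con cPrf iPrf w) dy))

  preserves-Prf-∀ : Preserves (Prf · (all · var 0 · var 1) ↪ Pi (El · var 0) (Prf · (var 2 · var 0)))
  preserves-Prf-∀ _ m d =
    let w = ⊢-ctx d ; iPrf = lhs-In m cPrf ; iAll = lhs-In m cAll
        iEl = In-type iAll cEl ; iProp = In-type iAll cProp
        dProp = ⊢con cProp iProp w
        dx , dp = quant-args (typeU-TypeIs iAll) (⊢con cSet (In-type iAll cSet) w) (⊢con cEl iEl w)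
                             dProp (head-arg iPrf refl dProp d)
    in retype-app (typeU-TypeIs iPrf) d (⊢Pi-fiber (app (⊢con cEl iEl w) dx) dp (⊢con cPrf iPrf))

  preserves-Prf-⊤ : Preserves (Prf · top ↪ Pi Prop (arr (Prf · var 0) (Prf · var 0)))
  preserves-Prf-⊤ _ m d =
    let w = ⊢-ctx d ; iPrf = lhs-In m cPrf
        dProp = ⊢con cProp (In-type iPrf cProp) w ; w₁ = ⊢-ext dProp
        dPz = app (⊢con cPrf iPrf w₁) (var w₁ here)
    in retype-app (typeU-TypeIs iPrf) d (prod sTYPE dProp (⊢-arr sTYPE dPz dPz))

  preserves-Prf-⊥ : Preserves (Prf · bot ↪ Pi Prop (Prf · var 0))
  preserves-Prf-⊥ _ m d =
    let w = ⊢-ctx d ; iPrf = lhs-In m cPrf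
        dProp = ⊢con cProp (In-type iPrf cProp) w ; w₁ = ⊢-ext dProp
    in retype-app (typeU-TypeIs iPrf) d (prod sTYPE dProp (app (⊢con cPrf iPrf w₁) (var w₁ here)))

  preserves-Prf-¬ : Preserves (Prf · (neg · var 0) ↪ arr (Prf · var 0) (Pi Prop (Prf · var 0)))
  preserves-Prf-¬ _ m d =
    let w = ⊢-ctx d ; iPrf = lhs-In m cPrf
        dProp = ⊢con cProp (In-type iPrf cProp) w ; w₁ = ⊢-ext dProp
        dx = arg-typed (typeU-TypeIs (lhs-In m cNeg)) sTYPE dProp (head-arg iPrf refl dProp d)
        d⊥ = prod sTYPE dProp (app (⊢con cPrf iPrf w₁) (var w₁ here))
    in retype-app (typeU-TypeIs iPrf) d (⊢-arr sTYPE (app (⊢con cPrf iPrf w) dx) d⊥)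

  preserves-Prf-∧ : Preserves (Prf · (and · var 0 · var 1) ↪
                               Pi Prop (arr (arr (Prf · var 1) (arr (Prf · var 2) (Prf · var 0))) (Prf · var 0)))
  preserves-Prf-∧ _ m d =
    let w = ⊢-ctx d ; iPrf = lhs-In m cPrf
        dProp = ⊢con cProp (In-type iPrf cProp) w
        dx , dy = args₂-typed (typeU-TypeIs (lhs-In m cAnd)) dProp (λ _ → dProp) (head-arg iPrf refl dProp d)
        w₁ = ⊢-ext dProp
        dPx = app (⊢con cPrf iPrf w₁) (⊢-wk w₁ dx) ; w₂ = ⊢-ext dPx
        dPy = app (⊢con cPrf iPrf w₂) (⊢-wk w₂ (⊢-wk w₁ dy)) ; w₃ = ⊢-ext dPy
        dPz₃ = app (⊢con cPrf iPrf w₃) (var w₃ (there (there here)))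
        dIntro = prod sTYPE dPx (prod sTYPE dPy dPz₃) ; w₄ = ⊢-ext dIntro
        dPz₄ = app (⊢con cPrf iPrf w₄) (var w₄ (there here))
    in retype-app (typeU-TypeIs iPrf) d (prod sTYPE dProp (prod sTYPE dIntro dPz₄))

  preserves-Prf-∨ : Preserves (Prf · (or · var 0 · var 1) ↪
                               Pi Prop (arr (arr (Prf · var 1) (Prf · var 0))
                                            (arr (arr (Prf · var 2) (Prf · var 0)) (Prf · var 0))))
  preserves-Prf-∨ _ m d =
    let w = ⊢-ctx d ; iPrf = lhs-In m cPrf
        dProp = ⊢con cProp (In-type iPrf cProp) w
        dx , dy = args₂-typed (typeU-TypeIs (lhs-In m cOr)) dProp (λ _ → dProp) (head-arg iPrf refl dProp d)
        w₁ = ⊢-ext dProp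
        dPx = app (⊢con cPrf iPrf w₁) (⊢-wk w₁ dx) ; w₂ = ⊢-ext dPx
        dInl = prod sTYPE dPx (app (⊢con cPrf iPrf w₂) (var w₂ (there here))) ; w₂' = ⊢-ext dInl
        dPy = app (⊢con cPrf iPrf w₂') (⊢-wk w₂' (⊢-wk w₁ dy)) ; w₃ = ⊢-ext dPy
        dInr = prod sTYPE dPy (app (⊢con cPrf iPrf w₃) (var w₃ (there (there here)))) ; w₄ = ⊢-ext dInr
        dPz₄ = app (⊢con cPrf iPrf w₄) (var w₄ (there (there here)))
    in retype-app (typeU-TypeIs iPrf) d (prod sTYPE dProp (prod sTYPE dInl (prod sTYPE dInr dPz₄)))

  preserves-Prf-∃ : Preserves (Prf · (ex · var 0 · var 1) ↪
                               Pi Prop (arr (Pi (El · var 1) (arr (Prf · (var 3 · var 0)) (Prf · var 1))) (Prf · var 0)))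
  preserves-Prf-∃ _ m d =
    let w = ⊢-ctx d ; iPrf = lhs-In m cPrf ; iEx = lhs-In m cEx
        iEl = In-type iEx cEl
        dProp = ⊢con cProp (In-type iPrf cProp) w
        da , dp = quant-args (typeU-TypeIs iEx) (⊢con cSet (In-type iEx cSet) w) (⊢con cEl iEl w) dProp
                             (head-arg iPrf refl dProp d)
        w₁ = ⊢-ext dProp
        dEa = app (⊢con cEl iEl w₁) (⊢-wk w₁ da) ; w₂ = ⊢-ext dEa
        dPpx = app (⊢con cPrf iPrf w₂) (app (⊢-wk w₂ (⊢-wk w₁ dp)) (var w₂ here)) ; w₃ = ⊢-ext dPpx
        dIntro = prod sTYPE dEa (prod sTYPE dPpx (app (⊢con cPrf iPrf w₃) (var w₃ (there (there here)))))
        w₄ = ⊢-ext dIntro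
    in retype-app (typeU-TypeIs iPrf) d (prod sTYPE dProp (prod sTYPE dIntro (app (⊢con cPrf iPrf w₄) (var w₄ (there here)))))

  preserves-Prfc : Preserves (Prfc ↪ lam Prop (Prf · (neg · (neg · var 0))))
  preserves-Prfc _ m d =
    let w = ⊢-ctx d
        dProp = ⊢con cProp (rhs-In m cProp) w ; w₁ = ⊢-ext dProp
        body = app (⊢con cPrf (rhs-In m cPrf) w₁) (¬¬-typed (rhs-In m cNeg) (var w₁ here))
    in retype-con (typeU-TypeIs (lhs-In m cPrfc)) d (abs sKIND dProp (sort w₁) body)

  preserves-⇒c : Preserves (impc ↪ lam Prop (lam Prop (imp · (neg · (neg · var 1)) · (neg · (neg · var 0)))))
  preserves-⇒c _ m d = retype-con (typeU-TypeIs (lhs-In m cImpc)) d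
    (⊢classical-connective (rhs-In m cImp) (rhs-In m cNeg) (rhs-In m cProp) refl (⊢-ctx d))

  preserves-∧c : Preserves (andc ↪ lam Prop (lam Prop (and · (neg · (neg · var 1)) · (neg · (neg · var 0)))))
  preserves-∧c _ m d = retype-con (typeU-TypeIs (lhs-In m cAndc)) d
    (⊢classical-connective (rhs-In m cAnd) (rhs-In m cNeg) (rhs-In m cProp) refl (⊢-ctx d))

  preserves-∨c : Preserves (orc ↪ lam Prop (lam Prop (or · (neg · (neg · var 1)) · (neg · (neg · var 0)))))
  preserves-∨c _ m d = retype-con (typeU-TypeIs (lhs-In m cOrc)) d
    (⊢classical-connective (rhs-In m cOr) (rhs-In m cNeg) (rhs-In m cProp) refl (⊢-ctx d))

  preserves-∀c : Preserves (allc ↪ lam Set' (lam (arr (El · var 0) Prop)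
                                      (all · var 1 · lam (El · var 1) (neg · (neg · (var 1 · var 0))))))
  preserves-∀c _ m d = retype-con (typeU-TypeIs (lhs-In m cAllc)) d
    (⊢classical-quantifier (rhs-In m cAll) (rhs-In m cNeg) (rhs-In m cProp) (rhs-In m cSet) (rhs-In m cEl) refl (⊢-ctx d))

  preserves-∃c : Preserves (exc ↪ lam Set' (lam (arr (El · var 0) Prop)
                                     (ex · var 1 · lam (El · var 1) (neg · (neg · (var 1 · var 0))))))
  preserves-∃c _ m d = retype-con (typeU-TypeIs (lhs-In m cExc)) d
    (⊢classical-quantifier (rhs-In m cEx) (rhs-In m cNeg) (rhs-In m cProp) (rhs-In m cSet) (rhs-In m cEl) refl (⊢-ctx d))

  preserves-El-o : Preserves (El · o ↪ Prop)
  preserves-El-o _ m d = retype-app (typeU-TypeIs (lhs-In m cEl)) d (⊢con cProp (rhs-In m cProp) (⊢-ctx d))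

  preserves-El-⇝ : Preserves (El · (arrS · var 0 · var 1) ↪ arr (El · var 0) (El · var 1))
  preserves-El-⇝ _ m d =
    let w = ⊢-ctx d ; iEl = lhs-In m cEl
        dSet = ⊢con cSet (In-type iEl cSet) w
        dx , dy = args₂-typed (typeU-TypeIs (lhs-In m cArrS)) dSet (λ _ → dSet) (head-arg iEl refl dSet d)
    in retype-app (typeU-TypeIs iEl) d (⊢-arr sTYPE (app (⊢con cEl iEl w) dx) (app (⊢con cEl iEl w) dy))

  preserves-El-⇝d : Preserves (El · (arrSd · var 0 · var 1) ↪ Pi (El · var 0) (El · (var 2 · var 0)))
  preserves-El-⇝d _ m d =
    let w = ⊢-ctx d ; iEl = lhs-In m cEl
        dSet = ⊢con cSet (In-type iEl cSet) w
        dx , dy = quant-args (typeU-TypeIs (lhs-In m cArrSd)) dSet (⊢con cEl iEl w) dSet (head-arg iEl refl dSet d)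
    in retype-app (typeU-TypeIs iEl) d (⊢Pi-fiber (app (⊢con cEl iEl w) dx) dy (⊢con cEl iEl))

  preserves-Prf-⇒d : Preserves (Prf · (impd · var 0 · var 1) ↪ Pi (Prf · var 0) (Prf · (var 2 · var 0)))
  preserves-Prf-⇒d _ m d =
    let w = ⊢-ctx d ; iPrf = lhs-In m cPrf
        dProp = ⊢con cProp (In-type iPrf cProp) w
        dx , dy = quant-args (typeU-TypeIs (lhs-In m cImpd)) dProp (⊢con cPrf iPrf w) dProp (head-arg iPrf refl dProp d)
    in retype-app (typeU-TypeIs iPrf) d (⊢Pi-fiber (app (⊢con cPrf iPrf w) dx) dy (⊢con cPrf iPrf))

  preserves-El-π : Preserves (El · (π · var 0 · var 1) ↪ Pi (Prf · var 0) (El · (var 2 · var 0)))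
  preserves-El-π _ m d =
    let w = ⊢-ctx d ; iEl = lhs-In m cEl ; iπ = lhs-In m cπ
        iPrf = In-type iπ cPrf
        dSet = ⊢con cSet (In-type iEl cSet) w
        dx , dy = quant-args (typeU-TypeIs iπ) (⊢con cProp (In-type iπ cProp) w) (⊢con cPrf iPrf w) dSet
                             (head-arg iEl refl dSet d)
    in retype-app (typeU-TypeIs iEl) d (⊢Pi-fiber (app (⊢con cPrf iPrf w) dx) dy (⊢con cEl iEl))

  preserves-pred-0 : Preserves (pred · z ↪ z)
  preserves-pred-0 _ m d = retype-app (typeU-TypeIs (lhs-In m cPred)) d (⊢con c0 (lhs-In m c0) (⊢-ctx d))

  preserves-pred-succ : Preserves (pred · (succ · var 0) ↪ var 0)
  preserves-pred-succ _ m d =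
    let iPred = lhs-In m cPred
        dI = ⊢con cI (In-type iPred cI) (⊢-ctx d)
        dx = arg-typed (typeU-TypeIs (lhs-In m cSucc)) sTYPE dI (arg-typed (typeU-TypeIs iPred) sTYPE dI d)
    in retype-app (typeU-TypeIs iPred) d dx

  preserves-positive-0 : Preserves (positive · z ↪ bot)
  preserves-positive-0 _ m d = retype-app (typeU-TypeIs (lhs-In m cPositive)) d (⊢con cBot (rhs-In m cBot) (⊢-ctx d))

  preserves-positive-succ : Preserves (positive · (succ · var 0) ↪ top)
  preserves-positive-succ _ m d = retype-app (typeU-TypeIs (lhs-In m cPositive)) d (⊢con cTop (rhs-In m cTop) (⊢-ctx d))

  preserves-pair-erase : Preserves (pair · var 0 · var 1 · var 2 · var 3 ↪ pair† · var 0 · var 1 · var 2)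
  preserves-pair-erase θ {Γ} m d =
    let t = θ 0 ; p = θ 1 ; x = θ 2 ; h = θ 3
        w = ⊢-ctx d ; iPair = lhs-In m cPair
        iEl = In-type iPair cEl
        k₀ = typeU-TypeIs {Γ} iPair ; k₁ = app-TypeIs {u = t} k₀ ; k₂ = app-TypeIs {u = p} k₁
        k₄ = app-TypeIs {u = h} (app-TypeIs {u = x} k₂)
        d₃ = proj₂ (fun-typed d) ; d₂ = proj₂ (fun-typed d₃) ; d₁ = proj₂ (fun-typed d₂)
        dt = arg-typed k₀ sTYPE (⊢con cSet (In-type iPair cSet) w) d₁
        dEt = app (⊢con cEl iEl w) dt
        dp = arg-typed k₁ sTYPE (⊢-arr sTYPE dEt (⊢con cProp (In-type iPair cProp) w)) d₂
        dx = arg-typed k₂ sTYPE (subst (λ X → Γ ⊢ El · X ∶ TYPE) (sym (wk-[] t p)) dEt) d₃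
        dRhs = app (app (app (⊢con cPair† (rhs-In m cPair†) w) dt) dp) dx
        rhs-type = El-psub-≡ (wk²-[][] t p x) (wk-[] p x)
        lhs-type = El-psub-≡ (trans (cong (λ X → sub (exts (single x)) X [ h ]) (extsⁿ-single-wk 2 p t)) (wk²-[][] t x h))
                             (wk²-[][] p x h)
    in retype (subst (TypeIs Γ _) lhs-type k₄) app-not-KIND d (⊢-≡ rhs-type dRhs)

  -- Injectivity of El ∘ psub under conversion identifies the index t of fst with the index t'
  -- of pair†, which is what lets x be retyped from El t' to El t.
  preserves-fst-pair† : Preserves (fst · var 0 · var 1 · (pair† · var 2 · var 3 · var 4) ↪ var 4)
  preserves-fst-pair† θ {Γ} m d =
    let t = θ 0 ; p = θ 1 ; t' = θ 2 ; p' = θ 3 ; x = θ 4 ; e = pair† · t' · p' · x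
        w = ⊢-ctx d ; iFst = lhs-In m cFst ; iPair† = lhs-In m cPair†
        iEl = In-type iFst cEl
        dSet = ⊢con cSet (In-type iFst cSet) w
        dArr : ∀ {a} → Γ ⊢ a ∶ Set' → Γ ⊢ arr (El · a) Prop ∶ TYPE
        dArr da = ⊢-arr sTYPE (app (⊢con cEl iEl w) da) (⊢con cProp (In-type iFst cProp) w)
        k₀ = typeU-TypeIs {Γ} iFst ; k₁ = app-TypeIs {u = t} k₀ ; k₂ = app-TypeIs {u = p} k₁
        d₂ = proj₂ (fun-typed d) ; d₁ = proj₂ (fun-typed d₂)
        dt = arg-typed k₀ sTYPE dSet d₁
        dp = arg-typed k₁ sTYPE (dArr dt) d₂
        dEt = app (⊢con cEl iEl w) dt
        dPsub = app (⊢con cEl iEl w) (app (app (⊢con cPsub (In-type iFst cPsub) w) dt) dp)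
        de = subst (λ X → Γ ⊢ e ∶ El · (psub · X · p)) (wk-[] t p)
                   (arg-typed k₂ sTYPE (subst (λ X → Γ ⊢ El · (psub · X · p) ∶ TYPE) (sym (wk-[] t p)) dPsub) d)
        q₀ = typeU-TypeIs {Γ} iPair† ; q₁ = app-TypeIs {u = t'} q₀ ; q₂ = app-TypeIs {u = p'} q₁
        q₃ = subst (TypeIs Γ e) (El-psub-≡ (wk²-[][] t' p' x) (wk-[] p' x))
                   (app-TypeIs {u = x} q₂)
        e₂ = proj₂ (fun-typed de) ; e₁ = proj₂ (fun-typed e₂)
        dt' = arg-typed q₀ sTYPE dSet e₁
        dx = subst (λ X → Γ ⊢ x ∶ El · X) (wk-[] t' p')
                   (arg-typed q₂ sTYPE (subst (λ X → Γ ⊢ El · X ∶ TYPE) (sym (wk-[] t' p')) (app (⊢con cEl iEl w) dt')) de)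
        t≡t' = El-psub-injective (q₃ de)
        lhs-type = cong (El ·_) (wk²-[][] t p e)
    in retype (subst (TypeIs Γ _) lhs-type (app-TypeIs {u = e} k₂)) app-not-KIND d
              (conv dx sTYPE dEt (≡βR-appʳ (≡βR-sym t≡t')))

  preserves-Ty-set : Preserves (TyC · set ↪ Set')
  preserves-Ty-set _ m d = retype-app (typeU-TypeIs (lhs-In m cTy)) d (⊢con cSet (rhs-In m cSet) (⊢-ctx d))

  preserves-Ty-⇝d : Preserves (TyC · (arrd1 · var 0 · var 1) ↪ Pi (El · var 0) (TyC · (var 2 · var 0)))
  preserves-Ty-⇝d _ m d =
    let w = ⊢-ctx d ; iTy = lhs-In m cTy ; iArr = lhs-In m cArrd1
        iEl = In-type iArr cEl
        dSet1 = ⊢con cSet1 (In-type iTy cSet1) w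
        dx , dy = quant-args (typeU-TypeIs iArr) (⊢con cSet (In-type iArr cSet) w) (⊢con cEl iEl w) dSet1
                             (head-arg iTy refl dSet1 d)
    in retype-app (typeU-TypeIs iTy) d (⊢Pi-fiber (app (⊢con cEl iEl w) dx) dy (⊢con cTy iTy))

  preserves-Els-↑ : Preserves (Els · (up · var 0) ↪ El · var 0)
  preserves-Els-↑ _ m d =
    let w = ⊢-ctx d ; iEls = lhs-In m cEls ; i↑ = lhs-In m c↑
        dScheme = ⊢con cScheme (In-type iEls cScheme) w
        dx = arg-typed (typeU-TypeIs i↑) sTYPE (⊢con cSet (In-type i↑ cSet) w) (head-arg iEls refl dScheme d)
    in retype-app (typeU-TypeIs iEls) d (app (⊢con cEl (rhs-In m cEl) w) dx)

  preserves-Els-A : Preserves (Els · (SA · var 0) ↪ Pi Set' (Els · (var 1 · var 0)))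
  preserves-Els-A _ m d =
    let w = ⊢-ctx d ; iEls = lhs-In m cEls ; iA = lhs-In m cSA
        iScheme = In-type iEls cScheme
        dSet = ⊢con cSet (In-type iA cSet) w ; w₁ = ⊢-ext dSet
        dScheme = ⊢con cScheme iScheme w
        dp = arg-typed (typeU-TypeIs iA) sTYPE (⊢-arr sTYPE dSet dScheme) (head-arg iEls refl dScheme d)
    in retype-app (typeU-TypeIs iEls) d (prod sTYPE dSet (app (⊢con cEls iEls w₁) (app (⊢-wk w₁ dp) (var w₁ here))))

  preserves-Prf-𝒜 : Preserves (Prf · (PA · var 0) ↪ Pi Set' (Prf · (var 1 · var 0)))
  preserves-Prf-𝒜 _ m d =
    let w = ⊢-ctx d ; iPrf = lhs-In m cPrf ; i𝒜 = lhs-In m cPA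
        dSet = ⊢con cSet (In-type i𝒜 cSet) w ; w₁ = ⊢-ext dSet
        dProp = ⊢con cProp (In-type iPrf cProp) w
        dp = arg-typed (typeU-TypeIs i𝒜) sTYPE (⊢-arr sTYPE dSet dProp) (head-arg iPrf refl dProp d)
    in retype-app (typeU-TypeIs iPrf) d (prod sTYPE dSet (app (⊢con cPrf iPrf w₁) (app (⊢-wk w₁ dp) (var w₁ here))))

  RU-preserved : All Preserves RU
  RU-preserved =
    preserves-El-ι ∷ preserves-Prf-⇒ ∷ preserves-Prf-∀ ∷ preserves-Prf-⊤ ∷ preserves-Prf-⊥ ∷ preserves-Prf-¬ ∷
    preserves-Prf-∧ ∷ preserves-Prf-∨ ∷ preserves-Prf-∃ ∷ preserves-Prfc ∷ preserves-⇒c ∷ preserves-∧c ∷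
    preserves-∨c ∷ preserves-∀c ∷ preserves-∃c ∷ preserves-El-o ∷ preserves-El-⇝ ∷ preserves-El-⇝d ∷
    preserves-Prf-⇒d ∷ preserves-El-π ∷ preserves-pred-0 ∷ preserves-pred-succ ∷ preserves-positive-0 ∷
    preserves-positive-succ ∷ preserves-pair-erase ∷ preserves-fst-pair† ∷ preserves-Ty-set ∷ preserves-Ty-⇝d ∷
    preserves-Els-↑ ∷ preserves-Els-A ∷ preserves-Prf-𝒜 ∷ []

theorem4p7 : ∀ (Sig₁ : Signature) (R₁ : Rules) → IsFragment Sig₁ R₁ ΣU RU → IsTheory Sig₁ R₁
theorem4p7 Sig₁ R₁ F = record
  { system     = IsFragment.system F
  ; confluence = λ _ _ _ _ → ↪-confluent
  ; preserve   = λ ρ m _ θ _ _ _ _ → All.lookup RU-preserved (IsFragment.rulesSub F ρ m) θ m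
  }
  where
  open Fragment Sig₁ R₁ F using (↪-confluent)
  open SubjectReduction Sig₁ R₁ F using (RU-preserved)
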